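{- Let $\mathbb{F}$ be a field of characteristic different from $2$. For every integer $n\ge 2$, \[\mathsf{dc}\big(\Sigma_{\{x_{1,1},x_{2,2}\}}\det_n\big)\ \ge\ 2(n-2).\]
   Context: $\det_n$ is the determinant of the $n\times n$ matrix $X=(x_{i,j})$ of distinct indeterminates. For a set $S$ of variables and a polynomial $p$, $p_S$ denotes $p$ with every variable of $S$ replaced by one new variable $y$, and $\Sigma_S p=p_S|_{y=0}+p_S|_{y=1}$; thus $\Sigma_{\{x_{1,1},x_{2,2}\}}\det_n=\det_n|_{x_{1,1}=x_{2,2}=0}+\det_n|_{x_{1,1}=x_{2,2}=1}$. The determinantal complexity $\mathsf{dc}(f)$ of a polynomial $f$ is the minimum $k$ such that $f=\lambda\det_k(M)$ for some $k\times k$ matrix $M$ whose entries are variables or field constants and some nonzero $\lambda\in\mathbb{F}$. -}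

module Defs where

open import Level using (Level; _⊔_)
open import Algebra.Bundles using (CommutativeRing)
import Data.Nat
open import Data.Nat using (ℕ; zero; suc)
open import Data.Fin using (Fin; zero; suc; punchIn)
open import Data.Fin.Patterns using (0F; 1F)
open import Data.Product using (_×_; _,_; Σ; ∃)
open import Data.Sum using (_⊎_; inj₁; inj₂; [_,_])
open import Data.Unit using (⊤; tt)
open import Data.Bool using (Bool; true; false; if_then_else_; not)
open import Relation.Nullary using (¬_)

record Field (c ℓ : Level) : Set (Level.suc (c ⊔ ℓ)) where
  field
    commutativeRing : CommutativeRing c ℓ
  open CommutativeRing commutativeRing public
  field
    1≉0     : ¬ (1# ≈ 0#)
    inverse : ∀ x → ¬ (x ≈ 0#) → ∃ λ y → (x * y) ≈ 1#

CharNot2 : ∀ {c ℓ} → Field c ℓ → Set ℓ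
CharNot2 F = ¬ ((1# + 1#) ≈ 0#) where open Field F

-- The polynomial ring 𝔽[V]: polynomial expressions in the variables V
-- modulo the commutative 𝔽-algebra laws (i.e. the free commutative
-- 𝔽-algebra on V, which is the polynomial ring).

module Poly {c ℓ} (F : Field c ℓ) where
  open Field F using (0#; 1#; _+_; _*_; -_) renaming (Carrier to K; _≈_ to _≈F_)

  infixl 6 _⊕_
  infixl 7 _⊗_
  data Expr (V : Set) : Set c where
    var : V → Expr V
    con : K → Expr V
    _⊕_ : Expr V → Expr V → Expr V
    _⊗_ : Expr V → Expr V → Expr V
    ⊝_  : Expr V → Expr V

  infix 4 _≈ₚ_
  data _≈ₚ_ {V : Set} : Expr V → Expr V → Set (c ⊔ ℓ) where
    ≈-refl  : ∀ {p} → p ≈ₚ p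
    ≈-sym   : ∀ {p q} → p ≈ₚ q → q ≈ₚ p
    ≈-trans : ∀ {p q r} → p ≈ₚ q → q ≈ₚ r → p ≈ₚ r
    ⊕-cong  : ∀ {p p' q q'} → p ≈ₚ p' → q ≈ₚ q' → p ⊕ q ≈ₚ p' ⊕ q'
    ⊗-cong  : ∀ {p p' q q'} → p ≈ₚ p' → q ≈ₚ q' → p ⊗ q ≈ₚ p' ⊗ q'
    ⊝-cong  : ∀ {p q} → p ≈ₚ q → ⊝ p ≈ₚ ⊝ q
    ⊕-assoc : ∀ p q r → (p ⊕ q) ⊕ r ≈ₚ p ⊕ (q ⊕ r)
    ⊕-comm  : ∀ p q → p ⊕ q ≈ₚ q ⊕ p
    ⊕-idˡ   : ∀ p → con 0# ⊕ p ≈ₚ p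
    ⊕-invˡ  : ∀ p → (⊝ p) ⊕ p ≈ₚ con 0#
    ⊗-assoc : ∀ p q r → (p ⊗ q) ⊗ r ≈ₚ p ⊗ (q ⊗ r)
    ⊗-comm  : ∀ p q → p ⊗ q ≈ₚ q ⊗ p
    ⊗-idˡ   : ∀ p → con 1# ⊗ p ≈ₚ p
    ⊗-distribʳ : ∀ p q r → (p ⊕ q) ⊗ r ≈ₚ (p ⊗ r) ⊕ (q ⊗ r)
    con-cong : ∀ {a b} → a ≈F b → con a ≈ₚ con b
    con-+    : ∀ a b → con a ⊕ con b ≈ₚ con (a + b)
    con-*    : ∀ a b → con a ⊗ con b ≈ₚ con (a * b)
    con--    : ∀ a → ⊝ con a ≈ₚ con (- a)

  substP : ∀ {V W} → (V → Expr W) → Expr V → Expr W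
  substP σ (var v) = σ v
  substP σ (con a) = con a
  substP σ (p ⊕ q) = substP σ p ⊕ substP σ q
  substP σ (p ⊗ q) = substP σ p ⊗ substP σ q
  substP σ (⊝ p)   = ⊝ substP σ p

  rename : ∀ {V W} → (V → W) → Expr V → Expr W
  rename ρ = substP (λ v → var (ρ v))

  sgn : ∀ {V} → Bool → Expr V → Expr V
  sgn true  p = p
  sgn false p = ⊝ p

  signedSum : ∀ {V} m → Bool → (Fin m → Expr V) → Expr V
  signedSum zero    s f = con 0#
  signedSum (suc m) s f = sgn s (f zero) ⊕ signedSum m (not s) (λ i → f (suc i))

  det : ∀ {V} k → (Fin k → Fin k → Expr V) → Expr V
  det zero    M = con 1#
  det (suc k) M =
    signedSum (suc k) true (λ i → M i zero ⊗ det k (λ r c → M (punchIn i r) (suc c)))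

  -- det_n = det of the generic n×n matrix X = (x_{i,j}); variables are
  -- indexed by Fin n × Fin n (0-based, so x_{1,1} is (0,0)).

  detGeneric : ∀ n → Expr (Fin n × Fin n)
  detGeneric n = det n (λ i j → var (i , j))

  -- p_S : replace every variable of S (a decidable subset of V) by one
  -- new variable y (= inj₂ tt); Σ_S p = p_S|_{y=0} + p_S|_{y=1}.

  collapse : ∀ {V} → (V → Bool) → Expr V → Expr (V ⊎ ⊤)
  collapse S = rename (λ v → if S v then inj₂ tt else inj₁ v)

  setY : ∀ {V} → K → Expr (V ⊎ ⊤) → Expr V
  setY a = substP [ var , (λ _ → con a) ]

  ΣS : ∀ {V} → (V → Bool) → Expr V → Expr V
  ΣS S p = setY 0# (collapse S p) ⊕ setY 1# (collapse S p)

  -- Determinantal complexity.  The ambient supply of variables is V ⊎ ℕ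
  -- (the variables of f plus countably many further ones); a matrix
  -- entry is a variable or a field constant.

  Entry : Set → Set c
  Entry V = (V ⊎ ℕ) ⊎ K

  entry : ∀ {V} → Entry V → Expr (V ⊎ ℕ)
  entry (inj₁ v) = var v
  entry (inj₂ a) = con a

  DetRep : ∀ {V} → Expr V → ℕ → Set (c ⊔ ℓ)
  DetRep {V} f k =
    Σ (Fin k → Fin k → Entry V) λ M → Σ K λ lam →
      (¬ (lam ≈F 0#)) ×
      (rename inj₁ f ≈ₚ con lam ⊗ det k (λ i j → entry (M i j)))

  dc≥ : ∀ {V} → Expr V → ℕ → Set (c ⊔ ℓ)
  dc≥ f b = ∀ k → DetRep f k → b Data.Nat.≤ k

-- the set S = {x_{1,1}, x_{2,2}} as a decidable subset of Fin n × Fin n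
-- (0-based: (0,0) and (1,1))
S₁₁₂₂ : ∀ {n} → Fin n × Fin n → Bool
S₁₁₂₂ (zero , zero)         = true
S₁₁₂₂ (suc zero , suc zero) = true
S₁₁₂₂ _                     = false

{-# OPTIONS --safe #-}

-- Following Mignon and Ressayre, we compare Hessians. If f = λ · det_k (M x) with M affine, the mixed
-- second derivative of f at x₀ in directions u, w is λ times that of det_k at M x₀ in the directions
-- given by the linear part of M. If f (x₀) = 0 then M x₀ is singular; for a kernel vector w with
-- w₀ ≠ 0, Cramer's rule and Laplace expansion write w₀ · ∂²det [U, W] as a sum of 2k products of a
-- linear form in U and one in W, so there the Hessian of det has rank at most 2k.
-- For f = Σ_{x₁₁,x₂₂} det_n in characteristic ≠ 2 take x₀ with bottom-right block the identity and
-- top-left block [[y, 1], [½, y]], where y replaces x₁₁ and x₂₂; then f (x₀) = (0 − ½) + (1 − ½) = 0.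
-- A Schur complement shows that on the off-diagonal blocks the Hessian of f at x₀ is a nondegenerate
-- pairing of rank 4 (n − 2), whence 4 (n − 2) ≤ 2k. Second derivatives are εη-coefficients in
-- F[ε, η] / (ε², η²); as equality in F is not decidable, the linear algebra runs in the double-negation
-- monad, which suffices for the decidable conclusion.

module Submission where

open import Algebra.Bundles using (CommutativeRing; RawRing)
open import Algebra.Morphism.Structures using (module RingMorphisms)
open import Data.Nat using (ℕ)
open import Defs

-- The ring solver over an arbitrary commutative ring, with integer coefficients since the ring's
-- equality need not be decidable. With the optimised _×_, con (+ 0) and con (+ 1) denote 0# and 1#
-- definitionally, as the solver's refl requires.
module ℤ-CoefficientRingSolver {c ℓ} (R : CommutativeRing c ℓ) where

  open import Algebra.Solver.Ring.AlmostCommutativeRing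
    using (AlmostCommutativeRing; _-Raw-AlmostCommutative⟶_; Induced-equivalence; fromCommutativeRing)
  open import Data.Integer as ℤ using (ℤ; +_; -[1+_]; _⊖_; _◃_; sign; ∣_∣)
  open import Data.Integer.Properties using ([1+m]⊖[1+n]≡m⊖n)
  open import Data.Maybe using (Maybe; just; nothing)
  open import Data.Nat as ℕ using (zero; suc)
  open import Data.Nat.Properties using (+-suc)
  open import Data.Sign as Sign using (Sign)
  open import Relation.Binary.PropositionalEquality using (_≡_; cong)
  open import Relation.Nullary using (yes; no)

  open CommutativeRing R
  open import Algebra.Properties.Ring ring using (-‿involutive; -0#≈0#; -‿distribˡ-*; -‿distribʳ-*; -‿+-comm)
  open import Algebra.Properties.Semiring.Mult.TCOptimised semiring using (_×_; 1+×; ×-homo-+; ×1-homo-*)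
  open import Algebra.Solver.CommutativeMonoid +-commutativeMonoid as +-Solver using (_⊕_; _⊜_)
  open import Relation.Binary.Reasoning.Setoid setoid

  fromℤ : ℤ → Carrier
  fromℤ (+ n)    = n × 1#
  fromℤ -[1+ n ] = - (suc n × 1#)

  fromℤ-⊖ : ∀ m n → fromℤ (m ⊖ n) ≈ m × 1# - n × 1#
  fromℤ-⊖ zero    zero    = sym (-‿inverseʳ 0#)
  fromℤ-⊖ (suc m) zero    = sym (trans (+-congˡ -0#≈0#) (+-identityʳ _))
  fromℤ-⊖ zero    (suc n) = sym (+-identityˡ _)
  fromℤ-⊖ (suc m) (suc n) = begin
    fromℤ (suc m ⊖ suc n)          ≡⟨ cong fromℤ ([1+m]⊖[1+n]≡m⊖n m n) ⟩
    fromℤ (m ⊖ n)                  ≈⟨ fromℤ-⊖ m n ⟩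
    a - b                          ≈⟨ +-identityˡ _ ⟨
    0# + (a - b)                   ≈⟨ +-congʳ (-‿inverseʳ 1#) ⟨
    (1# - 1#) + (a - b)            ≈⟨ +-Solver.solve 4 (λ x y z w → (x ⊕ z) ⊕ (y ⊕ w) ⊜ (x ⊕ y) ⊕ (z ⊕ w)) refl 1# a (- 1#) (- b) ⟩
    (1# + a) + (- 1# - b)          ≈⟨ +-congˡ (-‿+-comm 1# b) ⟩
    (1# + a) - (1# + b)            ≈⟨ +-cong (1+× m 1#) (-‿cong (1+× n 1#)) ⟨
    suc m × 1# - suc n × 1#        ∎
    where
    a = m × 1#
    b = n × 1#

  fromℤ-+ : ∀ i j → fromℤ (i ℤ.+ j) ≈ fromℤ i + fromℤ j
  fromℤ-+ (+ m)    (+ n)    = ×-homo-+ 1# m n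
  fromℤ-+ (+ m)    -[1+ n ] = fromℤ-⊖ m (suc n)
  fromℤ-+ -[1+ m ] (+ n)    = trans (fromℤ-⊖ n (suc m)) (+-comm _ _)
  fromℤ-+ -[1+ m ] -[1+ n ] = begin
    - (suc (suc (m ℕ.+ n)) × 1#)       ≡⟨ cong (λ k → - (suc k × 1#)) (+-suc m n) ⟨
    - ((suc m ℕ.+ suc n) × 1#)         ≈⟨ -‿cong (×-homo-+ 1# (suc m) (suc n)) ⟩
    - (suc m × 1# + suc n × 1#)        ≈⟨ -‿+-comm _ _ ⟨
    - (suc m × 1#) - (suc n × 1#)      ∎

  fromℤ-neg : ∀ i → fromℤ (ℤ.- i) ≈ - fromℤ i
  fromℤ-neg (+ zero)  = sym -0#≈0#
  fromℤ-neg (+ suc n) = refl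
  fromℤ-neg -[1+ n ]  = sym (-‿involutive _)

  signed : Sign → Carrier → Carrier
  signed Sign.+ x = x
  signed Sign.- x = - x

  signed-cong : ∀ s {x y} → x ≈ y → signed s x ≈ signed s y
  signed-cong Sign.+ x≈y = x≈y
  signed-cong Sign.- x≈y = -‿cong x≈y

  signed-* : ∀ s t x y → signed (s Sign.* t) (x * y) ≈ signed s x * signed t y
  signed-* Sign.+ Sign.+ x y = refl
  signed-* Sign.+ Sign.- x y = -‿distribʳ-* x y
  signed-* Sign.- Sign.+ x y = -‿distribˡ-* x y
  signed-* Sign.- Sign.- x y = begin
    x * y         ≈⟨ -‿involutive _ ⟨
    - - (x * y)   ≈⟨ -‿cong (-‿distribˡ-* x y) ⟩
    - (- x * y)   ≈⟨ -‿distribʳ-* _ _ ⟩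
    - x * - y     ∎

  fromℤ-◃ : ∀ s n → fromℤ (s ◃ n) ≈ signed s (n × 1#)
  fromℤ-◃ Sign.+ zero    = refl
  fromℤ-◃ Sign.- zero    = sym -0#≈0#
  fromℤ-◃ Sign.+ (suc n) = refl
  fromℤ-◃ Sign.- (suc n) = refl

  fromℤ-sign-abs : ∀ i → fromℤ i ≈ signed (sign i) (∣ i ∣ × 1#)
  fromℤ-sign-abs (+ n)    = refl
  fromℤ-sign-abs -[1+ n ] = refl

  fromℤ-* : ∀ i j → fromℤ (i ℤ.* j) ≈ fromℤ i * fromℤ j
  fromℤ-* i j = begin
    fromℤ (s ◃ ∣ i ∣ ℕ.* ∣ j ∣)                        ≈⟨ fromℤ-◃ s (∣ i ∣ ℕ.* ∣ j ∣) ⟩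
    signed s ((∣ i ∣ ℕ.* ∣ j ∣) × 1#)                   ≈⟨ signed-cong s (×1-homo-* ∣ i ∣ ∣ j ∣) ⟩
    signed s (∣ i ∣ × 1# * ∣ j ∣ × 1#)                  ≈⟨ signed-* (sign i) (sign j) _ _ ⟩
    signed (sign i) (∣ i ∣ × 1#) * signed (sign j) (∣ j ∣ × 1#) ≈⟨ *-cong (fromℤ-sign-abs i) (fromℤ-sign-abs j) ⟨
    fromℤ i * fromℤ j                                  ∎
    where s = sign i Sign.* sign j

  private
    ℤ-rawRing : RawRing _ _
    ℤ-rawRing = record
      { Carrier = ℤ ; _≈_ = _≡_ ; _+_ = ℤ._+_ ; _*_ = ℤ._*_ ; -_ = ℤ.-_ ; 0# = + 0 ; 1# = + 1 }

    almostCommutativeRing : AlmostCommutativeRing c ℓ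
    almostCommutativeRing = fromCommutativeRing R

    fromℤ-homomorphism : ℤ-rawRing -Raw-AlmostCommutative⟶ almostCommutativeRing
    fromℤ-homomorphism = record
      { ⟦_⟧ = fromℤ ; +-homo = fromℤ-+ ; *-homo = fromℤ-* ; -‿homo = fromℤ-neg ; 0-homo = refl ; 1-homo = refl }

    _≟ℤ_ : ∀ i j → Maybe (Induced-equivalence fromℤ-homomorphism i j)
    i ≟ℤ j with i ℤ.≟ j
    ... | yes _≡_.refl = just refl
    ... | no _         = nothing

  open import Algebra.Solver.Ring ℤ-rawRing almostCommutativeRing fromℤ-homomorphism _≟ℤ_ public

module FiniteSums {c ℓ} (R : CommutativeRing c ℓ) where

  open import Data.Fin using (Fin; zero; suc; punchIn; splitAt)
  open import Data.Fin.Properties using (punchInᵢ≢i; suc-injective)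
  open import Data.Nat using (zero; suc)
  open import Data.Sum using (inj₁; inj₂)
  open import Data.Vec.Functional using (_++_)
  open import Function using (_∘_)
  open import Relation.Binary.PropositionalEquality as ≡ using (_≡_; _≢_)

  open CommutativeRing R hiding (zero)
  open import Algebra.Properties.Ring ring using (-1*x≈-x)
  open import Algebra.Properties.Semiring.Sum semiring public
    using (sum; sum-cong-≋; ∑-distrib-+; *-distribˡ-sum)
  open import Algebra.Properties.Semiring.Sum semiring using (sum-replicate-zero; sum-remove)
  open import Relation.Binary.Reasoning.Setoid setoid

  *-zeroʳ-≈ : ∀ x {y} → y ≈ 0# → x * y ≈ 0#
  *-zeroʳ-≈ x y≈0 = trans (*-congˡ y≈0) (zeroʳ x)

  *-zeroˡ-≈ : ∀ {x} y → x ≈ 0# → x * y ≈ 0#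
  *-zeroˡ-≈ y x≈0 = trans (*-congʳ x≈0) (zeroˡ y)

  sum-zero : ∀ {m} {f : Fin m → Carrier} → (∀ i → f i ≈ 0#) → sum f ≈ 0#
  sum-zero {m} f≈0 = trans (sum-cong-≋ f≈0) (sum-replicate-zero m)

  sum-single : ∀ {m} (f : Fin m → Carrier) i → (∀ j → j ≢ i → f j ≈ 0#) → sum f ≈ f i
  sum-single {suc m} f i others≈0 = begin
    sum f                              ≈⟨ sum-remove f ⟩
    f i + sum (f ∘ punchIn i)          ≈⟨ +-congˡ (sum-zero (λ j → others≈0 (punchIn i j) (punchInᵢ≢i i j))) ⟩
    f i + 0#                           ≈⟨ +-identityʳ _ ⟩
    f i                                ∎

  sum-neg : ∀ {m} (f : Fin m → Carrier) → sum (λ i → - f i) ≈ - sum f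
  sum-neg f = begin
    sum (λ i → - f i)        ≈⟨ sum-cong-≋ (λ i → sym (-1*x≈-x (f i))) ⟩
    sum (λ i → - 1# * f i)   ≈⟨ *-distribˡ-sum (- 1#) f ⟨
    - 1# * sum f             ≈⟨ -1*x≈-x _ ⟩
    - sum f                  ∎

  sum-update : ∀ {m} (f g : Fin m → Carrier) j x → (∀ c → c ≢ j → f c ≈ g c) → f j ≈ g j + x → sum f ≈ sum g + x
  sum-update f g zero    x others≈ fj≈ = trans (+-cong fj≈ (sum-cong-≋ (λ c → others≈ (suc c) (λ ()))))
    (trans (+-assoc _ _ _) (trans (+-congˡ (+-comm x _)) (sym (+-assoc _ _ _))))
  sum-update f g (suc j) x others≈ fj≈ =
    trans (+-cong (others≈ zero (λ ())) (sum-update (f ∘ suc) (g ∘ suc) j x (λ c c≢j → others≈ (suc c) (c≢j ∘ suc-injective)) fj≈))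
          (sym (+-assoc _ _ _))

  ++-zipWith : ∀ {m n} (xs xs′ : Fin m → Carrier) (ys ys′ : Fin n → Carrier) i →
               (xs ++ ys) i * (xs′ ++ ys′) i ≡ ((λ j → xs j * xs′ j) ++ (λ j → ys j * ys′ j)) i
  ++-zipWith {m} xs xs′ ys ys′ i with splitAt m i
  ... | inj₁ _ = ≡.refl
  ... | inj₂ _ = ≡.refl

  sum-++ : ∀ {m n} (xs : Fin m → Carrier) (ys : Fin n → Carrier) → sum (xs ++ ys) ≈ sum xs + sum ys
  sum-++ {zero}  xs ys = sym (+-identityˡ _)
  sum-++ {suc m} xs ys = trans (+-congˡ (trans (sum-cong-≋ tail≈) (sum-++ (xs ∘ suc) ys))) (sym (+-assoc _ _ _))
    where
    tail≈ : ∀ i → (xs ++ ys) (suc i) ≈ ((xs ∘ suc) ++ ys) i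
    tail≈ i with splitAt m i
    ... | inj₁ _ = refl
    ... | inj₂ _ = refl

module Determinant {c ℓ} (R : CommutativeRing c ℓ) where

  open import Data.Bool using (Bool; true; false; not)
  open import Data.Empty using (⊥-elim)
  open import Data.Fin using (Fin; zero; suc; punchIn; punchOut; toℕ; fromℕ<)
  open import Data.Fin.Properties using (suc-injective; punchIn-punchOut; toℕ<n; toℕ-fromℕ<; toℕ-injective) renaming (_≟_ to _≟ᶠ_)
  open import Data.Nat using (ℕ; zero; suc; _<?_)
  import Data.Nat.Properties as ℕ
  open import Data.Product using (Σ; _,_)
  open import Data.Sum using (inj₁; inj₂)
  open import Data.Vec.Functional using (_++_)
  open import Function using (_∘_)
  open import Relation.Binary.PropositionalEquality as ≡ using (_≡_; _≢_; _≗_)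
  open import Relation.Nullary using (Dec; yes; no)

  open CommutativeRing R hiding (zero)
  open import Algebra.Properties.Ring ring using (-‿involutive; -0#≈0#; -‿distribˡ-*; -‿distribʳ-*; -‿+-comm; -1*x≈-x; +-inverseʳ-unique)
  open FiniteSums R public
  open ℤ-CoefficientRingSolver R using (solve; _:=_; _:+_; _:*_; :-_; _:-_)
  open import Relation.Binary.Reasoning.Setoid setoid

  Matrix : ℕ → Set c
  Matrix k = Fin k → Fin k → Carrier

  infixl 7 _*ᵥ_
  _*ᵥ_ : ∀ {k} → Matrix k → (Fin k → Carrier) → Fin k → Carrier
  (M *ᵥ w) i = sum (λ c → M i c * w c)

  sgn : Bool → Carrier → Carrier
  sgn true  x = x
  sgn false x = - x

  signedSum : ∀ m → Bool → (Fin m → Carrier) → Carrier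
  signedSum zero    s f = 0#
  signedSum (suc m) s f = sgn s (f zero) + signedSum m (not s) (f ∘ suc)

  minor : ∀ {k} → Fin (suc k) → Matrix (suc k) → Matrix k
  minor i M r c = M (punchIn i r) (suc c)

  -- Laplace expansion along the first column, as in Poly.det, so that evaluation commutes with det clause by clause.
  det : ∀ k → Matrix k → Carrier
  det zero    M = 1#
  det (suc k) M = signedSum (suc k) true (λ i → M i zero * det k (minor i M))

  sgn-cong : ∀ s {x y} → x ≈ y → sgn s x ≈ sgn s y
  sgn-cong true  x≈y = x≈y
  sgn-cong false x≈y = -‿cong x≈y

  sgn-not : ∀ s x → sgn (not s) x ≈ - sgn s x
  sgn-not true  x = refl
  sgn-not false x = sym (-‿involutive x)

  sgn-+ : ∀ s x y → sgn s (x + y) ≈ sgn s x + sgn s y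
  sgn-+ true  x y = refl
  sgn-+ false x y = sym (-‿+-comm x y)

  sgn-*ˡ : ∀ s x y → sgn s x * y ≈ sgn s (x * y)
  sgn-*ˡ true  x y = refl
  sgn-*ˡ false x y = sym (-‿distribˡ-* x y)

  sgn-*ʳ : ∀ s x y → sgn s (x * y) ≈ x * sgn s y
  sgn-*ʳ true  x y = refl
  sgn-*ʳ false x y = -‿distribʳ-* x y

  sgn-zero : ∀ s {x} → x ≈ 0# → sgn s x ≈ 0#
  sgn-zero true  x≈0 = x≈0
  sgn-zero false x≈0 = trans (-‿cong x≈0) -0#≈0#

  sgn-zero⁻¹ : ∀ s {x} → sgn s x ≈ 0# → x ≈ 0#
  sgn-zero⁻¹ true  sx≈0 = sx≈0
  sgn-zero⁻¹ false sx≈0 = trans (sym (-‿involutive _)) (sgn-zero false sx≈0)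

  parity : ∀ {m} → Bool → Fin m → Bool
  parity s zero    = s
  parity s (suc i) = parity (not s) i

  signedSum≈sum : ∀ m s f → signedSum m s f ≈ sum (λ i → sgn (parity s i) (f i))
  signedSum≈sum zero    s f = refl
  signedSum≈sum (suc m) s f = +-congˡ (signedSum≈sum m (not s) (f ∘ suc))

  *-signedSum≈sum-++ : ∀ {n} ρ (x y x′ y′ : Fin n → Carrier) →
    ρ * signedSum n true (λ i → x i * y i + x′ i * y′ i)
      ≈ sum (λ m → ((λ i → ρ * sgn (parity true i) (x i)) ++ (λ i → ρ * sgn (parity true i) (x′ i))) m * (y ++ y′) m)
  *-signedSum≈sum-++ {n} ρ x y x′ y′ = begin
    ρ * signedSum n true (λ i → x i * y i + x′ i * y′ i)
      ≈⟨ *-congˡ (signedSum≈sum n true (λ i → x i * y i + x′ i * y′ i)) ⟩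
    ρ * sum (λ i → signed i (x i * y i + x′ i * y′ i))
      ≈⟨ *-congˡ (sum-cong-≋ (λ i → sgn-+ (parity true i) (x i * y i) (x′ i * y′ i))) ⟩
    ρ * sum (λ i → signed i (x i * y i) + signed i (x′ i * y′ i))
      ≈⟨ *-congˡ (∑-distrib-+ (λ i → signed i (x i * y i)) (λ i → signed i (x′ i * y′ i))) ⟩
    ρ * (sum (λ i → signed i (x i * y i)) + sum (λ i → signed i (x′ i * y′ i)))
      ≈⟨ distribˡ ρ (sum (λ i → signed i (x i * y i))) (sum (λ i → signed i (x′ i * y′ i))) ⟩
    ρ * sum (λ i → signed i (x i * y i)) + ρ * sum (λ i → signed i (x′ i * y′ i))
      ≈⟨ +-cong (*-distribˡ-sum ρ (λ i → signed i (x i * y i))) (*-distribˡ-sum ρ (λ i → signed i (x′ i * y′ i))) ⟩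
    sum (λ i → ρ * signed i (x i * y i)) + sum (λ i → ρ * signed i (x′ i * y′ i))
      ≈⟨ +-cong (sum-cong-≋ (λ i → pull i (x i) (y i))) (sum-cong-≋ (λ i → pull i (x′ i) (y′ i))) ⟨
    sum (λ i → ρ * signed i (x i) * y i) + sum (λ i → ρ * signed i (x′ i) * y′ i)
      ≈⟨ sum-++ (λ i → ρ * signed i (x i) * y i) (λ i → ρ * signed i (x′ i) * y′ i) ⟨
    sum ((λ i → ρ * signed i (x i) * y i) ++ (λ i → ρ * signed i (x′ i) * y′ i))
      ≈⟨ sum-cong-≋ (λ m → reflexive (++-zipWith (λ i → ρ * signed i (x i)) y (λ i → ρ * signed i (x′ i)) y′ m)) ⟨
    sum (λ m → ((λ i → ρ * signed i (x i)) ++ (λ i → ρ * signed i (x′ i))) m * (y ++ y′) m) ∎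
    where
    signed : Fin n → Carrier → Carrier
    signed i = sgn (parity true i)
    pull : ∀ i a b → ρ * signed i a * b ≈ ρ * signed i (a * b)
    pull i a b = trans (*-assoc ρ (signed i a) b) (*-congˡ (sgn-*ˡ (parity true i) a b))

  signedSum-cong : ∀ m s {f g : Fin m → Carrier} → (∀ i → f i ≈ g i) → signedSum m s f ≈ signedSum m s g
  signedSum-cong zero    s f≈g = refl
  signedSum-cong (suc m) s f≈g = +-cong (sgn-cong s (f≈g zero)) (signedSum-cong m (not s) (f≈g ∘ suc))

  signedSum-not : ∀ m s f → signedSum m (not s) f ≈ - signedSum m s f
  signedSum-not zero    s f = sym -0#≈0#
  signedSum-not (suc m) s f = begin
    sgn (not s) (f zero) + signedSum m (not (not s)) (f ∘ suc)   ≈⟨ +-cong (sgn-not s _) (signedSum-not m (not s) _) ⟩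
    - sgn s (f zero) + - signedSum m (not s) (f ∘ suc)           ≈⟨ -‿+-comm _ _ ⟩
    - (sgn s (f zero) + signedSum m (not s) (f ∘ suc))           ∎

  signedSum-+ : ∀ m s f g → signedSum m s (λ i → f i + g i) ≈ signedSum m s f + signedSum m s g
  signedSum-+ zero    s f g = sym (+-identityˡ 0#)
  signedSum-+ (suc m) s f g = begin
    sgn s (f zero + g zero) + signedSum m (not s) (λ i → f (suc i) + g (suc i))
      ≈⟨ +-cong (sgn-+ s _ _) (signedSum-+ m (not s) _ _) ⟩
    (sgn s (f zero) + sgn s (g zero)) + (signedSum m (not s) (f ∘ suc) + signedSum m (not s) (g ∘ suc))
      ≈⟨ solve 4 (λ a b c d → (a :+ b) :+ (c :+ d) := (a :+ c) :+ (b :+ d)) refl _ _ _ _ ⟩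
    signedSum (suc m) s f + signedSum (suc m) s g ∎

  signedSum-*ˡ : ∀ m s t f → signedSum m s (λ i → t * f i) ≈ t * signedSum m s f
  signedSum-*ˡ zero    s t f = sym (zeroʳ t)
  signedSum-*ˡ (suc m) s t f = begin
    sgn s (t * f zero) + signedSum m (not s) (λ i → t * f (suc i))  ≈⟨ +-cong (sgn-*ʳ s t _) (signedSum-*ˡ m (not s) t _) ⟩
    t * sgn s (f zero) + t * signedSum m (not s) (f ∘ suc)          ≈⟨ distribˡ _ _ _ ⟨
    t * signedSum (suc m) s f                                       ∎

  signedSum-neg : ∀ m s f → signedSum m s (λ i → - f i) ≈ - signedSum m s f
  signedSum-neg m s f = begin
    signedSum m s (λ i → - f i)        ≈⟨ signedSum-cong m s (λ i → sym (-1*x≈-x (f i))) ⟩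
    signedSum m s (λ i → - 1# * f i)   ≈⟨ signedSum-*ˡ m s (- 1#) f ⟩
    - 1# * signedSum m s f             ≈⟨ -1*x≈-x _ ⟩
    - signedSum m s f                  ∎

  signedSum-zero : ∀ m s {f} → (∀ i → f i ≈ 0#) → signedSum m s f ≈ 0#
  signedSum-zero zero    s f≈0 = refl
  signedSum-zero (suc m) s f≈0 =
    trans (+-cong (sgn-zero s (f≈0 zero)) (signedSum-zero m (not s) (f≈0 ∘ suc))) (+-identityˡ 0#)

  signedSum-single : ∀ m s f (i : Fin m) → (∀ j → j ≢ i → f j ≈ 0#) → Σ Bool (λ b → signedSum m s f ≈ sgn b (f i))
  signedSum-single (suc m) s f zero    others≈0 =
    s , trans (+-congˡ (signedSum-zero m (not s) (λ j → others≈0 (suc j) (λ ())))) (+-identityʳ _)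
  signedSum-single (suc m) s f (suc i) others≈0
    with signedSum-single m (not s) (f ∘ suc) i (λ j j≢i → others≈0 (suc j) (j≢i ∘ suc-injective))
  ... | b , eq = b , trans (+-cong (sgn-zero s (others≈0 zero (λ ()))) eq) (+-identityˡ _)

  det-cong : ∀ k {M N : Matrix k} → (∀ i j → M i j ≈ N i j) → det k M ≈ det k N
  det-cong zero    M≈N = refl
  det-cong (suc k) M≈N =
    signedSum-cong (suc k) true (λ i → *-cong (M≈N i zero) (det-cong k (λ r c → M≈N (punchIn i r) (suc c))))

  AgreeOff : ∀ {k} → Fin k → Matrix k → Matrix k → Set ℓ
  AgreeOff col M N = ∀ i j → j ≢ col → M i j ≈ N i j

  minor-agreeOff : ∀ {k} {col : Fin k} {M N : Matrix (suc k)} i → AgreeOff (suc col) M N → AgreeOff col (minor i M) (minor i N)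
  minor-agreeOff i M≈N r j j≢col = M≈N (punchIn i r) (suc j) (j≢col ∘ suc-injective)

  det-additive : ∀ k (col : Fin k) {M₁ M₂ M : Matrix k} → AgreeOff col M₁ M → AgreeOff col M₂ M →
                 (∀ i → M i col ≈ M₁ i col + M₂ i col) → det k M ≈ det k M₁ + det k M₂
  det-additive (suc k) zero {M₁} {M₂} {M} M₁≈M M₂≈M M≈M₁+M₂ = begin
    signedSum (suc k) true (λ i → M i zero * det k (minor i M))
      ≈⟨ signedSum-cong (suc k) true (λ i → *-cong (M≈M₁+M₂ i) (det-cong k (λ r c → sym (M₁≈M (punchIn i r) (suc c) (λ ()))))) ⟩
    signedSum (suc k) true (λ i → (M₁ i zero + M₂ i zero) * det k (minor i M₁))
      ≈⟨ signedSum-cong (suc k) true (λ i → trans (distribʳ (det k (minor i M₁)) (M₁ i zero) (M₂ i zero)) (+-congˡ (*-congˡ (minors≈ i)))) ⟩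
    signedSum (suc k) true (λ i → M₁ i zero * det k (minor i M₁) + M₂ i zero * det k (minor i M₂))
      ≈⟨ signedSum-+ (suc k) true (λ i → M₁ i zero * det k (minor i M₁)) (λ i → M₂ i zero * det k (minor i M₂)) ⟩
    det (suc k) M₁ + det (suc k) M₂ ∎
    where
    minors≈ : ∀ i → det k (minor i M₁) ≈ det k (minor i M₂)
    minors≈ i = det-cong k (λ r c → trans (M₁≈M (punchIn i r) (suc c) (λ ())) (sym (M₂≈M (punchIn i r) (suc c) (λ ()))))
  det-additive (suc k) (suc col) {M₁} {M₂} {M} M₁≈M M₂≈M M≈M₁+M₂ = begin
    signedSum (suc k) true (λ i → M i zero * det k (minor i M))
      ≈⟨ signedSum-cong (suc k) true (λ i → *-cong (sym (M₁≈M i zero (λ ())))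
           (det-additive k col (minor-agreeOff i M₁≈M) (minor-agreeOff i M₂≈M) (M≈M₁+M₂ ∘ punchIn i))) ⟩
    signedSum (suc k) true (λ i → M₁ i zero * (det k (minor i M₁) + det k (minor i M₂)))
      ≈⟨ signedSum-cong (suc k) true (λ i → trans (distribˡ (M₁ i zero) (det k (minor i M₁)) (det k (minor i M₂))) (+-congˡ (*-congʳ (firsts≈ i)))) ⟩
    signedSum (suc k) true (λ i → M₁ i zero * det k (minor i M₁) + M₂ i zero * det k (minor i M₂))
      ≈⟨ signedSum-+ (suc k) true (λ i → M₁ i zero * det k (minor i M₁)) (λ i → M₂ i zero * det k (minor i M₂)) ⟩
    det (suc k) M₁ + det (suc k) M₂ ∎
    where
    firsts≈ : ∀ i → M₁ i zero ≈ M₂ i zero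
    firsts≈ i = trans (M₁≈M i zero (λ ())) (sym (M₂≈M i zero (λ ())))

  det-homogeneous : ∀ k (col : Fin k) t {M N : Matrix k} → AgreeOff col M N →
                    (∀ i → N i col ≈ t * M i col) → det k N ≈ t * det k M
  det-homogeneous (suc k) zero t {M} {N} M≈N N≈tM = begin
    signedSum (suc k) true (λ i → N i zero * det k (minor i N))
      ≈⟨ signedSum-cong (suc k) true (λ i → trans (*-cong (N≈tM i) (det-cong k (λ r c → sym (M≈N (punchIn i r) (suc c) (λ ())))))
                                                  (*-assoc t _ _)) ⟩
    signedSum (suc k) true (λ i → t * (M i zero * det k (minor i M)))
      ≈⟨ signedSum-*ˡ (suc k) true t (λ i → M i zero * det k (minor i M)) ⟩
    t * det (suc k) M ∎
  det-homogeneous (suc k) (suc col) t {M} {N} M≈N N≈tM = begin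
    signedSum (suc k) true (λ i → N i zero * det k (minor i N))
      ≈⟨ signedSum-cong (suc k) true (λ i → *-cong (sym (M≈N i zero (λ ()))) (det-homogeneous k col t (minor-agreeOff i M≈N) (N≈tM ∘ punchIn i))) ⟩
    signedSum (suc k) true (λ i → M i zero * (t * det k (minor i M)))
      ≈⟨ signedSum-cong (suc k) true (λ i → solve 3 (λ a b c → a :* (b :* c) := b :* (a :* c)) refl (M i zero) t (det k (minor i M))) ⟩
    signedSum (suc k) true (λ i → t * (M i zero * det k (minor i M)))
      ≈⟨ signedSum-*ˡ (suc k) true t (λ i → M i zero * det k (minor i M)) ⟩
    t * det (suc k) M ∎

  replaceColumn : ∀ {k} → Fin k → (Fin k → Carrier) → Matrix k → Matrix k
  replaceColumn col v M i j with j ≟ᶠ col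
  ... | yes _ = v i
  ... | no  _ = M i j

  replaceColumn-at : ∀ {k} (col : Fin k) v M i → replaceColumn col v M i col ≈ v i
  replaceColumn-at col v M i with col ≟ᶠ col
  ... | yes _    = refl
  ... | no  ≢col = ⊥-elim (≢col ≡.refl)

  replaceColumn-agreeOff : ∀ {k} (col : Fin k) v M → AgreeOff col (replaceColumn col v M) M
  replaceColumn-agreeOff col v M i j j≢col with j ≟ᶠ col
  ... | yes j≡col = ⊥-elim (j≢col j≡col)
  ... | no  _     = refl

  replaceColumn-agreeOff₂ : ∀ {k} (col : Fin k) v w M → AgreeOff col (replaceColumn col v M) (replaceColumn col w M)
  replaceColumn-agreeOff₂ col v w M i j j≢col =
    trans (replaceColumn-agreeOff col v M i j j≢col) (sym (replaceColumn-agreeOff col w M i j j≢col))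

  replaceColumn-congᵒ : ∀ {k} {col : Fin k} d v {M N} → AgreeOff col M N → AgreeOff col (replaceColumn d v M) (replaceColumn d v N)
  replaceColumn-congᵒ d v M≈N i j j≢col with j ≟ᶠ d
  ... | yes _ = refl
  ... | no  _ = M≈N i j j≢col

  replaceColumn-self : ∀ {k} (col : Fin k) M i j → replaceColumn col (λ r → M r col) M i j ≈ M i j
  replaceColumn-self col M i j with j ≟ᶠ col
  ... | yes ≡.refl = refl
  ... | no  _      = refl

  lift₀ : ∀ {n m} → (Fin n → Fin m) → Fin (suc n) → Fin (suc m)
  lift₀ g zero    = zero
  lift₀ g (suc r) = suc (g r)

  lift₀-cong : ∀ {n m} {g h : Fin n → Fin m} → g ≗ h → lift₀ g ≗ lift₀ h
  lift₀-cong g≗h zero    = ≡.refl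
  lift₀-cong g≗h (suc r) = ≡.cong suc (g≗h r)

  RespectsPointwise : ∀ {n m} → ((Fin n → Fin m) → Carrier) → Set ℓ
  RespectsPointwise Φ = ∀ {g h} → g ≗ h → Φ g ≈ Φ h

  -- The Laplace expansion along the first two columns of a matrix whose first two columns
  -- are both x and whose remaining columns, restricted to the rows g, have determinant Φ g.
  twiceExpanded : ∀ n → (Fin (suc (suc n)) → Carrier) → ((Fin n → Fin (suc (suc n))) → Carrier) → Carrier
  twiceExpanded n x Φ =
    signedSum (suc (suc n)) true (λ i → x i * signedSum (suc n) true (λ j → x (punchIn i j) * Φ (punchIn i ∘ punchIn j)))

  twiceExpanded-peel : ∀ n x Φ (Q : Fin (suc n) → Carrier) →
    (∀ i → signedSum n false (λ j → x (suc (punchIn i j)) * Φ (punchIn (suc i) ∘ punchIn (suc j))) ≈ - Q i) →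
    twiceExpanded n x Φ ≈ signedSum (suc n) true (λ i → x (suc i) * Q i)
  twiceExpanded-peel n x Φ Q rest≈-Q = begin
    x₀ * A + signedSum (suc n) false (λ i → x (suc i) * (x₀ * P i + rest i))
      ≈⟨ +-congˡ (signedSum-cong (suc n) false {λ i → x (suc i) * (x₀ * P i + rest i)} (λ i → *-congˡ (+-congˡ (rest≈-Q i)))) ⟩
    x₀ * A + signedSum (suc n) false (λ i → x (suc i) * (x₀ * P i - Q i))
      ≈⟨ +-congˡ (signedSum-not (suc n) true (λ i → x (suc i) * (x₀ * P i - Q i))) ⟩
    x₀ * A - signedSum (suc n) true (λ i → x (suc i) * (x₀ * P i - Q i))
      ≈⟨ +-congˡ (-‿cong (signedSum-cong (suc n) true (λ i →
           solve 4 (λ a b c d → a :* (b :* c :- d) := b :* (a :* c) :+ :- (a :* d)) refl (x (suc i)) x₀ (P i) (Q i)))) ⟩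
    x₀ * A - signedSum (suc n) true (λ i → x₀ * (x (suc i) * P i) + - (x (suc i) * Q i))
      ≈⟨ +-congˡ (-‿cong (trans (signedSum-+ (suc n) true (λ i → x₀ * (x (suc i) * P i)) (λ i → - (x (suc i) * Q i)))
                                (+-cong (signedSum-*ˡ (suc n) true x₀ (λ i → x (suc i) * P i))
                                        (signedSum-neg (suc n) true (λ i → x (suc i) * Q i))))) ⟩
    x₀ * A - (x₀ * A - B)
      ≈⟨ solve 2 (λ a b → a :- (a :- b) := b) refl (x₀ * A) B ⟩
    B ∎
    where
    x₀ = x zero
    P : Fin (suc n) → Carrier
    P i = Φ (suc ∘ punchIn i)
    A = signedSum (suc n) true (λ j → x (suc j) * P j)
    rest : Fin (suc n) → Carrier
    rest i = signedSum n false (λ j → x (suc (punchIn i j)) * Φ (punchIn (suc i) ∘ punchIn (suc j)))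
    B = signedSum (suc n) true (λ i → x (suc i) * Q i)

  twiceExpanded≈0 : ∀ n x Φ → RespectsPointwise Φ → twiceExpanded n x Φ ≈ 0#
  twiceExpanded≈0 zero x Φ Φ-resp = begin
    twiceExpanded zero x Φ                                   ≈⟨ twiceExpanded-peel zero x Φ (λ _ → 0#) (λ _ → sym -0#≈0#) ⟩
    signedSum 1 true (λ i → x (suc i) * 0#)                  ≈⟨ signedSum-zero 1 true (λ i → zeroʳ (x (suc i))) ⟩
    0#                                                       ∎
  twiceExpanded≈0 (suc n) x Φ Φ-resp = begin
    twiceExpanded (suc n) x Φ                                ≈⟨ twiceExpanded-peel (suc n) x Φ _ rest≈ ⟩
    twiceExpanded n (x ∘ suc) (Φ ∘ lift₀)                    ≈⟨ twiceExpanded≈0 n (x ∘ suc) (Φ ∘ lift₀) (Φ-resp ∘ lift₀-cong) ⟩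
    0#                                                       ∎
    where
    punchIn-suc : ∀ i j → punchIn (suc i) ∘ punchIn (suc j) ≗ lift₀ (punchIn i ∘ punchIn j)
    punchIn-suc i j zero    = ≡.refl
    punchIn-suc i j (suc r) = ≡.refl
    rest≈ : ∀ i → signedSum (suc n) false (λ j → x (suc (punchIn i j)) * Φ (punchIn (suc i) ∘ punchIn (suc j)))
                ≈ - signedSum (suc n) true (λ j → x (suc (punchIn i j)) * Φ (lift₀ (punchIn i ∘ punchIn j)))
    rest≈ i = trans (signedSum-not (suc n) true (λ j → x (suc (punchIn i j)) * Φ (punchIn (suc i) ∘ punchIn (suc j))))
                    (-‿cong (signedSum-cong (suc n) true {λ j → x (suc (punchIn i j)) * Φ (punchIn (suc i) ∘ punchIn (suc j))}
                                            (λ j → *-congˡ (Φ-resp (punchIn-suc i j)))))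

  det-equalColumns₀₁ : ∀ k (M : Matrix (suc (suc k))) → (∀ i → M i zero ≈ M i (suc zero)) → det (suc (suc k)) M ≈ 0#
  det-equalColumns₀₁ k M col₀≈col₁ = begin
    det (suc (suc k)) M
      ≈⟨ signedSum-cong (suc (suc k)) true column₁≈column₀ ⟩
    twiceExpanded k (λ i → M i zero) Φ
      ≈⟨ twiceExpanded≈0 k (λ i → M i zero) Φ (λ g≗h → det-cong k (λ r c → reflexive (≡.cong (λ i → M i (suc (suc c))) (g≗h r)))) ⟩
    0# ∎
    where
    Φ : (Fin k → Fin (suc (suc k))) → Carrier
    Φ g = det k (λ r c → M (g r) (suc (suc c)))
    column₁≈column₀ : ∀ i → M i zero * det (suc k) (minor i M)
                          ≈ M i zero * signedSum (suc k) true (λ j → M (punchIn i j) zero * Φ (punchIn i ∘ punchIn j))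
    column₁≈column₀ i = *-congˡ (signedSum-cong (suc k) true {λ j → M (punchIn i j) (suc zero) * Φ (punchIn i ∘ punchIn j)}
                                                 (λ j → *-congʳ (sym (col₀≈col₁ (punchIn i j)))))

  swap₀ : ∀ {k} → Fin k → Fin (suc k) → Fin (suc k)
  swap₀ b zero    = suc b
  swap₀ b (suc j) with j ≟ᶠ b
  ... | yes _ = zero
  ... | no  _ = suc j

  swap₀-hit : ∀ {k} (b : Fin k) → swap₀ b (suc b) ≡ zero
  swap₀-hit b with b ≟ᶠ b
  ... | yes _   = ≡.refl
  ... | no  b≢b = ⊥-elim (b≢b ≡.refl)

  swap₀-miss : ∀ {k} {b j : Fin k} → j ≢ b → swap₀ b (suc j) ≡ suc j
  swap₀-miss {b = b} {j} j≢b with j ≟ᶠ b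
  ... | yes j≡b = ⊥-elim (j≢b j≡b)
  ... | no  _   = ≡.refl

  -- Swapping columns 0 and suc b negates det, since det is alternating and bilinear in that pair of columns.
  module ColumnPair {k} (b : Fin k) (N : Matrix (suc k)) where

    withColumns : (u v : Fin (suc k) → Carrier) → Matrix (suc k)
    withColumns u v = replaceColumn zero u (replaceColumn (suc b) v N)

    D : (u v : Fin (suc k) → Carrier) → Carrier
    D u v = det (suc k) (withColumns u v)

    withColumns-zero : ∀ u v r → withColumns u v r zero ≈ u r
    withColumns-zero u v r = replaceColumn-at zero u (replaceColumn (suc b) v N) r

    withColumns-suc : ∀ u v r j → withColumns u v r (suc j) ≈ replaceColumn (suc b) v N r (suc j)
    withColumns-suc u v r j = replaceColumn-agreeOff zero u (replaceColumn (suc b) v N) r (suc j) (λ ())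

    withColumns-suc-b : ∀ u v r → withColumns u v r (suc b) ≈ v r
    withColumns-suc-b u v r = trans (withColumns-suc u v r b) (replaceColumn-at (suc b) v N r)

    D-additiveˡ : ∀ u u′ v → D (λ r → u r + u′ r) v ≈ D u v + D u′ v
    D-additiveˡ u u′ v = det-additive (suc k) zero
      (replaceColumn-agreeOff₂ zero u (λ r → u r + u′ r) (replaceColumn (suc b) v N))
      (replaceColumn-agreeOff₂ zero u′ (λ r → u r + u′ r) (replaceColumn (suc b) v N))
      (λ r → trans (withColumns-zero (λ r → u r + u′ r) v r) (sym (+-cong (withColumns-zero u v r) (withColumns-zero u′ v r))))

    D-additiveʳ : ∀ u v v′ → D u (λ r → v r + v′ r) ≈ D u v + D u v′
    D-additiveʳ u v v′ = det-additive (suc k) (suc b)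
      (replaceColumn-congᵒ zero u (replaceColumn-agreeOff₂ (suc b) v (λ r → v r + v′ r) N))
      (replaceColumn-congᵒ zero u (replaceColumn-agreeOff₂ (suc b) v′ (λ r → v r + v′ r) N))
      (λ r → trans (withColumns-suc-b u (λ r → v r + v′ r) r) (sym (+-cong (withColumns-suc-b u v r) (withColumns-suc-b u v′ r))))

    alternating⇒antisymmetric : (∀ u → D u u ≈ 0#) → ∀ x y → D x y + D y x ≈ 0#
    alternating⇒antisymmetric D-diagonal x y = begin
      D x y + D y x
        ≈⟨ solve 4 (λ a b c d → b :+ c := (a :+ b) :+ (c :+ d) :- (a :+ d)) refl (D x x) (D x y) (D y x) (D y y) ⟩
      ((D x x + D x y) + (D y x + D y y)) - (D x x + D y y)
        ≈⟨ +-cong (sym (trans (D-additiveˡ x y x+y) (+-cong (D-additiveʳ x x y) (D-additiveʳ y x y))))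
                  (-‿cong (+-cong (D-diagonal x) (D-diagonal y))) ⟩
      D x+y x+y - (0# + 0#)
        ≈⟨ +-cong (D-diagonal x+y) (-‿cong (+-identityˡ 0#)) ⟩
      0# - 0#
        ≈⟨ -‿inverseʳ 0# ⟩
      0# ∎
      where
      x+y : Fin (suc k) → Carrier
      x+y r = x r + y r

    x y : Fin (suc k) → Carrier
    x r = N r zero
    y r = N r (suc b)

    withColumns-self : ∀ r c → withColumns x y r c ≈ N r c
    withColumns-self r zero    = withColumns-zero x y r
    withColumns-self r (suc j) = trans (withColumns-suc x y r j) (replaceColumn-self (suc b) N r (suc j))

    withColumns-swapped : ∀ r c → N r (swap₀ b c) ≈ withColumns y x r c
    withColumns-swapped r zero    = sym (withColumns-zero y x r)
    withColumns-swapped r (suc j) = bySwap (j ≟ᶠ b)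
      where
      bySwap : Dec (j ≡ b) → N r (swap₀ b (suc j)) ≈ withColumns y x r (suc j)
      bySwap (yes ≡.refl) = trans (reflexive (≡.cong (N r) (swap₀-hit b))) (sym (withColumns-suc-b y x r))
      bySwap (no j≢b)     = trans (reflexive (≡.cong (N r) (swap₀-miss j≢b)))
        (sym (trans (withColumns-suc y x r j) (replaceColumn-agreeOff (suc b) x N r (suc j) (j≢b ∘ suc-injective))))

  mutual
    det-swap₀ : ∀ k (b : Fin k) (N : Matrix (suc k)) → det (suc k) (λ r c → N r (swap₀ b c)) ≈ - det (suc k) N
    det-swap₀ k b N = begin
      det (suc k) (λ r c → N r (swap₀ b c))  ≈⟨ det-cong (suc k) withColumns-swapped ⟩
      D y x                                   ≈⟨ +-inverseʳ-unique (D x y) (D y x) (alternating⇒antisymmetric D-diagonal x y) ⟩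
      - D x y                                 ≈⟨ -‿cong (det-cong (suc k) withColumns-self) ⟩
      - det (suc k) N                         ∎
      where
      open ColumnPair b N
      D-diagonal : ∀ u → D u u ≈ 0#
      D-diagonal u = det-equalColumns₀ k b (withColumns u u) (λ r → trans (withColumns-zero u u r) (sym (withColumns-suc-b u u r)))

    det-equalColumns₀ : ∀ k (b : Fin k) (M : Matrix (suc k)) → (∀ i → M i zero ≈ M i (suc b)) → det (suc k) M ≈ 0#
    det-equalColumns₀ (suc k) zero    M col₀≈col₁ = det-equalColumns₀₁ k M col₀≈col₁
    det-equalColumns₀ (suc k) (suc b) M col₀≈col = begin
      det (suc (suc k)) M
        ≈⟨ -‿involutive _ ⟨
      - - det (suc (suc k)) M
        ≈⟨ -‿cong (signedSum-neg (suc (suc k)) true (λ i → M i zero * det (suc k) (minor i M))) ⟨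
      - signedSum (suc (suc k)) true (λ i → - (M i zero * det (suc k) (minor i M)))
        ≈⟨ -‿cong (signedSum-cong (suc (suc k)) true (λ i →
             trans (-‿distribʳ-* (M i zero) (det (suc k) (minor i M))) (*-congˡ (sym (det-swap₀ k b (minor i M)))))) ⟩
      - det (suc (suc k)) M′
        ≈⟨ -‿cong (det-equalColumns₀₁ k M′ col₀≈col) ⟩
      - 0#
        ≈⟨ -0#≈0# ⟩
      0# ∎
      where
      M′ : Matrix (suc (suc k))
      M′ r c = M r (lift₀ (swap₀ b) c)

    det-equalColumns : ∀ k (a b : Fin k) (M : Matrix k) → a ≢ b → (∀ i → M i a ≈ M i b) → det k M ≈ 0#
    det-equalColumns (suc k) zero    zero    M a≢b col≈ = ⊥-elim (a≢b ≡.refl)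
    det-equalColumns (suc k) zero    (suc b) M a≢b col≈ = det-equalColumns₀ k b M col≈
    det-equalColumns (suc k) (suc a) zero    M a≢b col≈ = det-equalColumns₀ k a M (sym ∘ col≈)
    det-equalColumns (suc k) (suc a) (suc b) M a≢b col≈ = signedSum-zero (suc k) true (λ i →
      *-zeroʳ-≈ (M i zero) (det-equalColumns k a b (minor i M) (a≢b ∘ ≡.cong suc) (col≈ ∘ punchIn i)))

  det-zeroRow : ∀ k (r : Fin k) (M : Matrix k) → (∀ c → M r c ≈ 0#) → det k M ≈ 0#
  det-zeroRow (suc k) r M row≈0 = signedSum-zero (suc k) true term≈0
    where
    term≈0 : ∀ i → M i zero * det k (minor i M) ≈ 0#
    term≈0 i with i ≟ᶠ r
    ... | yes ≡.refl = *-zeroˡ-≈ (det k (minor i M)) (row≈0 zero)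
    ... | no  i≢r    = *-zeroʳ-≈ (M i zero) (det-zeroRow k (punchOut i≢r) (minor i M) (λ c →
                         trans (reflexive (≡.cong (λ z → M z (suc c)) (punchIn-punchOut i≢r))) (row≈0 (suc c))))

  det-copyColumn : ∀ k (col d : Fin k) (M : Matrix k) → col ≢ d → det k (replaceColumn col (λ i → M i d) M) ≈ 0#
  det-copyColumn k col d M col≢d = det-equalColumns k col d (replaceColumn col (λ i → M i d) M) col≢d (λ i →
    trans (replaceColumn-at col (λ i → M i d) M i) (sym (replaceColumn-agreeOff col (λ i → M i d) M i d (col≢d ∘ ≡.sym))))

  det-addColumnMultiple : ∀ k (col d : Fin k) → col ≢ d → ∀ t {M M′ : Matrix k} → AgreeOff col M′ M →
                          (∀ i → M′ i col ≈ M i col + t * M i d) → det k M′ ≈ det k M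
  det-addColumnMultiple k col d col≢d t {M} {M′} M′≈M M′≈M+td = begin
    det k M′                                          ≈⟨ det-additive k col (λ i j j≢col → sym (M′≈M i j j≢col)) tdAgrees column≈ ⟩
    det k M + det k tdColumn                          ≈⟨ +-congˡ (det-homogeneous k col t (replaceColumn-agreeOff₂ col _ _ M) scaled) ⟩
    det k M + t * det k (replaceColumn col dColumn M)  ≈⟨ +-congˡ (*-zeroʳ-≈ t (det-copyColumn k col d M col≢d)) ⟩
    det k M + 0#                                      ≈⟨ +-identityʳ _ ⟩
    det k M                                           ∎
    where
    dColumn tdColumn′ : Fin k → Carrier
    dColumn i = M i d
    tdColumn′ i = t * M i d
    tdColumn : Matrix k
    tdColumn = replaceColumn col tdColumn′ M
    tdAgrees : AgreeOff col tdColumn M′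
    tdAgrees i j j≢col = trans (replaceColumn-agreeOff col tdColumn′ M i j j≢col) (sym (M′≈M i j j≢col))
    column≈ : ∀ i → M′ i col ≈ M i col + tdColumn i col
    column≈ i = trans (M′≈M+td i) (+-congˡ (sym (replaceColumn-at col tdColumn′ M i)))
    scaled : ∀ i → tdColumn i col ≈ t * replaceColumn col dColumn M i col
    scaled i = trans (replaceColumn-at col tdColumn′ M i) (*-congˡ (sym (replaceColumn-at col dColumn M i)))

  det-columnSum : ∀ k (col : Fin k) m (t : Fin m → Carrier) (v : Fin m → Fin k → Carrier) {M M′ : Matrix k} →
                  AgreeOff col M′ M → (∀ i → M′ i col ≈ sum (λ d → t d * v d i)) →
                  det k M′ ≈ sum (λ d → t d * det k (replaceColumn col (v d) M))
  det-columnSum k col zero t v {M} {M′} M′≈M M′≈sum =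
    trans (det-homogeneous k col 0# (λ i j j≢col → sym (M′≈M i j j≢col)) (λ i → trans (M′≈sum i) (sym (zeroˡ (M i col)))))
          (zeroˡ (det k M))
  det-columnSum k col (suc m) t v {M} {M′} M′≈M M′≈sum = begin
    det k M′
      ≈⟨ det-additive k col (agrees head) (agrees rest) (λ i →
           trans (M′≈sum i) (sym (+-cong (replaceColumn-at col head M i) (replaceColumn-at col rest M i)))) ⟩
    det k (replaceColumn col head M) + det k (replaceColumn col rest M)
      ≈⟨ +-cong (det-homogeneous k col (t zero) (replaceColumn-agreeOff₂ col (v zero) head M)
                  (λ i → trans (replaceColumn-at col head M i) (*-congˡ (sym (replaceColumn-at col (v zero) M i)))))
                (det-columnSum k col m (t ∘ suc) (v ∘ suc) (replaceColumn-agreeOff col rest M) (replaceColumn-at col rest M)) ⟩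
    sum (λ d → t d * det k (replaceColumn col (v d) M)) ∎
    where
    head rest : Fin k → Carrier
    head i = t zero * v zero i
    rest i = sum (λ d → t (suc d) * v (suc d) i)
    agrees : ∀ w → AgreeOff col (replaceColumn col w M) M′
    agrees w i j j≢col = trans (replaceColumn-agreeOff col w M i j j≢col) (sym (M′≈M i j j≢col))

  det-addColumnCombination : ∀ k (col : Fin k) (t : Fin k → Carrier) → t col ≈ 0# → {M M′ : Matrix k} → AgreeOff col M′ M →
                             (∀ i → M′ i col ≈ M i col + sum (λ d → t d * M i d)) → det k M′ ≈ det k M
  det-addColumnCombination k col t tcol≈0 {M} {M′} M′≈M M′≈M+∑ = begin
    det k M′
      ≈⟨ det-additive k col (λ i j j≢col → sym (M′≈M i j j≢col)) combinationAgrees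
           (λ i → trans (M′≈M+∑ i) (+-congˡ (sym (replaceColumn-at col combination M i)))) ⟩
    det k M + det k (replaceColumn col combination M)
      ≈⟨ +-congˡ (det-columnSum k col k t (λ d i → M i d) (replaceColumn-agreeOff col combination M) (replaceColumn-at col combination M)) ⟩
    det k M + sum (λ d → t d * det k (replaceColumn col (λ i → M i d) M))
      ≈⟨ +-congˡ (sum-zero term≈0) ⟩
    det k M + 0#
      ≈⟨ +-identityʳ _ ⟩
    det k M ∎
    where
    combination : Fin k → Carrier
    combination i = sum (λ d → t d * M i d)
    combinationAgrees : AgreeOff col (replaceColumn col combination M) M′
    combinationAgrees i j j≢col = trans (replaceColumn-agreeOff col combination M i j j≢col) (sym (M′≈M i j j≢col))
    term≈0 : ∀ d → t d * det k (replaceColumn col (λ i → M i d) M) ≈ 0#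
    term≈0 d with col ≟ᶠ d
    ... | yes ≡.refl = *-zeroˡ-≈ _ tcol≈0
    ... | no  col≢d  = *-zeroʳ-≈ (t d) (det-copyColumn k col d M col≢d)

  module _ {k} (M : Matrix (suc k)) (t : Fin k → Carrier) where

    firstColumnAdded : ℕ → Matrix (suc k)
    firstColumnAdded n i zero    = M i zero
    firstColumnAdded n i (suc c) with toℕ c <? n
    ... | yes _ = M i (suc c) + t c * M i zero
    ... | no  _ = M i (suc c)

    firstColumnAdded-step : ∀ n → det (suc k) (firstColumnAdded (suc n)) ≈ det (suc k) (firstColumnAdded n)
    firstColumnAdded-step n with n <? k
    ... | no n≮k = det-cong (suc k) unchanged
      where
      unchanged : ∀ i j → firstColumnAdded (suc n) i j ≈ firstColumnAdded n i j
      unchanged i zero = refl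
      unchanged i (suc c) with toℕ c <? suc n | toℕ c <? n
      ... | yes _    | yes _    = refl
      ... | no  _    | no  _    = refl
      ... | _        | no  c≮n  = ⊥-elim (c≮n (ℕ.<-≤-trans (toℕ<n c) (ℕ.≮⇒≥ n≮k)))
      ... | no  c≮1+n | yes c<n = ⊥-elim (c≮1+n (ℕ.m<n⇒m<1+n c<n))
    ... | yes n<k = det-addColumnMultiple (suc k) (suc c₀) zero (λ ()) (t c₀) agrees added
      where
      c₀ = fromℕ< n<k
      agrees : AgreeOff (suc c₀) (firstColumnAdded (suc n)) (firstColumnAdded n)
      agrees i zero    _ = refl
      agrees i (suc c) c≢c₀ with toℕ c <? suc n | toℕ c <? n
      ... | yes _     | yes _   = refl
      ... | no  _     | no  _   = refl
      ... | no  c≮1+n | yes c<n = ⊥-elim (c≮1+n (ℕ.m<n⇒m<1+n c<n))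
      ... | yes c<1+n | no  c≮n with ℕ.m<1+n⇒m<n∨m≡n c<1+n
      ...   | inj₁ c<n = ⊥-elim (c≮n c<n)
      ...   | inj₂ c≡n = ⊥-elim (c≢c₀ (≡.cong suc (toℕ-injective (≡.trans c≡n (≡.sym (toℕ-fromℕ< n<k))))))
      added : ∀ i → firstColumnAdded (suc n) i (suc c₀) ≈ firstColumnAdded n i (suc c₀) + t c₀ * M i zero
      added i with toℕ c₀ <? suc n | toℕ c₀ <? n
      ... | yes _     | no _    = refl
      ... | _         | yes c<n = ⊥-elim (ℕ.<-irrefl (toℕ-fromℕ< n<k) c<n)
      ... | no  c≮1+n | _       = ⊥-elim (c≮1+n (ℕ.≤-reflexive (≡.cong suc (toℕ-fromℕ< n<k))))

    det-firstColumnAdded : ∀ n → det (suc k) (firstColumnAdded n) ≈ det (suc k) M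
    det-firstColumnAdded zero    = det-cong (suc k) none
      where
      none : ∀ i j → firstColumnAdded zero i j ≈ M i j
      none i zero = refl
      none i (suc c) with toℕ c <? zero
      ... | no _ = refl
    det-firstColumnAdded (suc n) = trans (firstColumnAdded-step n) (det-firstColumnAdded n)

    det-addFirstColumnMultiples : ∀ {M′ : Matrix (suc k)} → (∀ i → M′ i zero ≈ M i zero) →
                                  (∀ i c → M′ i (suc c) ≈ M i (suc c) + t c * M i zero) → det (suc k) M′ ≈ det (suc k) M
    det-addFirstColumnMultiples {M′} column₀≈ columns≈ = trans (det-cong (suc k) all) (det-firstColumnAdded k)
      where
      all : ∀ i j → M′ i j ≈ firstColumnAdded k i j
      all i zero = column₀≈ i
      all i (suc c) with toℕ c <? k
      ... | yes _ = columns≈ i c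
      ... | no c≮k = ⊥-elim (c≮k (toℕ<n c))

  det-firstColumn-e₀ : ∀ k (M : Matrix (suc k)) → (∀ i → M (suc i) zero ≈ 0#) → det (suc k) M ≈ M zero zero * det k (minor zero M)
  det-firstColumn-e₀ k M below≈0 = trans (+-congˡ (signedSum-zero k false (λ i → *-zeroˡ-≈ _ (below≈0 i)))) (+-identityʳ _)

  det-identity : ∀ k (M : Matrix k) → (∀ i → M i i ≈ 1#) → (∀ i j → i ≢ j → M i j ≈ 0#) → det k M ≈ 1#
  det-identity zero    M diagonal≈1 offDiagonal≈0 = refl
  det-identity (suc k) M diagonal≈1 offDiagonal≈0 = begin
    det (suc k) M                       ≈⟨ det-firstColumn-e₀ k M (λ i → offDiagonal≈0 (suc i) zero (λ ())) ⟩
    M zero zero * det k (minor zero M)  ≈⟨ *-cong (diagonal≈1 zero) (det-identity k (minor zero M) (diagonal≈1 ∘ suc)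
                                                    (λ i j i≢j → offDiagonal≈0 (suc i) (suc j) (i≢j ∘ suc-injective))) ⟩
    1# * 1#                             ≈⟨ *-identityˡ 1# ⟩
    1#                                  ∎

  det-replaceColumn-*ᵥ : ∀ k (col : Fin k) (N : Matrix k) w → det k (replaceColumn col (N *ᵥ w) N) ≈ w col * det k N
  det-replaceColumn-*ᵥ (suc k) col N w = begin
    det (suc k) (replaceColumn col (N *ᵥ w) N)
      ≈⟨ det-columnSum (suc k) col (suc k) w (λ d i → N i d) (replaceColumn-agreeOff col (N *ᵥ w) N)
           (λ i → trans (replaceColumn-at col (N *ᵥ w) N i) (sum-cong-≋ (λ d → *-comm (N i d) (w d)))) ⟩
    sum (λ d → w d * det (suc k) (replaceColumn col (λ i → N i d) N))
      ≈⟨ sum-single _ col other≈0 ⟩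
    w col * det (suc k) (replaceColumn col (λ i → N i col) N)
      ≈⟨ *-congˡ (det-cong (suc k) (replaceColumn-self col N)) ⟩
    w col * det (suc k) N ∎
    where
    other≈0 : ∀ d → d ≢ col → w d * det (suc k) (replaceColumn col (λ i → N i d) N) ≈ 0#
    other≈0 d d≢col = *-zeroʳ-≈ (w d) (det-copyColumn (suc k) col d N (d≢col ∘ ≡.sym))

  det-replaceColumn₀ : ∀ k v (N : Matrix (suc k)) → det (suc k) (replaceColumn zero v N) ≈ signedSum (suc k) true (λ i → v i * det k (minor i N))
  det-replaceColumn₀ k v N = signedSum-cong (suc k) true (λ i → *-cong (replaceColumn-at zero v N i)
    (det-cong k (λ r c → replaceColumn-agreeOff zero v N (punchIn i r) (suc c) (λ ()))))

module _ {c ℓ c′ ℓ′} (R : CommutativeRing c ℓ) (S : CommutativeRing c′ ℓ′) where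

  private
    module R = CommutativeRing R
    module S = CommutativeRing S
  open RingMorphisms R.rawRing S.rawRing

  mkIsRingHomomorphism : ∀ {h : R.Carrier → S.Carrier} →
    (∀ {x y} → x R.≈ y → h x S.≈ h y) → (∀ x y → h (x R.+ y) S.≈ h x S.+ h y) → (∀ x y → h (x R.* y) S.≈ h x S.* h y) →
    (∀ x → h (R.- x) S.≈ S.- h x) → h R.0# S.≈ S.0# → h R.1# S.≈ S.1# → IsRingHomomorphism h
  mkIsRingHomomorphism h-cong h-+ h-* h-neg h-0 h-1 = record
    { isSemiringHomomorphism = record
      { isNearSemiringHomomorphism = record
        { +-isMonoidHomomorphism = record
          { isMagmaHomomorphism = record { isRelHomomorphism = record { cong = h-cong } ; homo = h-+ }
          ; ε-homo = h-0
          }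
        ; *-homo = h-*
        }
      ; 1#-homo = h-1
      }
    ; -‿homo = h-neg
    }

  module _ {h : R.Carrier → S.Carrier} (isHom : IsRingHomomorphism h) where

    open import Data.Bool using (true; false; not)
    open import Data.Fin using (Fin; zero; suc)
    open import Data.Nat using (zero; suc)
    open import Function using (_∘_)
    open IsRingHomomorphism isHom
    private
      module DR = Determinant R
      module DS = Determinant S

    sgn-homo : ∀ s x → h (DR.sgn s x) S.≈ DS.sgn s (h x)
    sgn-homo true  x = S.refl
    sgn-homo false x = -‿homo x

    signedSum-homo : ∀ m s (f : Fin m → R.Carrier) → h (DR.signedSum m s f) S.≈ DS.signedSum m s (h ∘ f)
    signedSum-homo zero    s f = 0#-homo
    signedSum-homo (suc m) s f =
      S.trans (+-homo _ _) (S.+-cong (sgn-homo s (f zero)) (signedSum-homo m (not s) (f ∘ suc)))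

    det-homo : ∀ k (M : DR.Matrix k) → h (DR.det k M) S.≈ DS.det k (λ i j → h (M i j))
    det-homo zero    M = 1#-homo
    det-homo (suc k) M = S.trans (signedSum-homo (suc k) true (λ i → M i zero R.* DR.det k (DR.minor i M)))
      (DS.signedSum-cong (suc k) true (λ i → S.trans (*-homo (M i zero) _) (S.*-congˡ (det-homo k (DR.minor i M)))))

module FieldLinearAlgebra {c ℓ} (F : Field c ℓ) where

  open import Data.Bool using (Bool; true)
  open import Data.Empty using (⊥; ⊥-elim)
  open import Data.Fin using (Fin; zero; suc; punchIn; punchOut)
  open import Data.Fin.Properties using (all?; ¬∀⟶∃¬; ∀-cons; punchIn-injective; punchInᵢ≢i; punchIn-punchOut)
    renaming (_≟_ to _≟ᶠ_)
  open import Data.Nat using (ℕ; zero; suc; _≤_; _≤?_; z≤n; s≤s)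
  open import Data.Nat.Properties using (m≤n⇒m≤1+n)
  open import Data.Product using (Σ; ∃; _,_; proj₁; proj₂)
  open import Data.Sum using (_⊎_; inj₁; inj₂)
  import Data.Integer as ℤ
  open import Function using (_∘_)
  open import Level using (_⊔_)
  open import Relation.Binary.PropositionalEquality as ≡ using (_≢_)
  open import Relation.Nullary using (¬_; Dec; yes; no)
  open import Relation.Nullary.Decidable using (decidable-stable; ¬¬-excluded-middle)
  open import Relation.Nullary.Negation using (¬¬-map)

  open Field F hiding (zero)
  open Determinant commutativeRing
  open ℤ-CoefficientRingSolver commutativeRing using (solve; _:=_; _:+_; _:*_; :-_; _:-_; con)
  open import Algebra.Properties.Ring ring using (-‿distribˡ-*)
  open import Relation.Binary.Reasoning.Setoid setoid

  ¬¬-∀-Fin : ∀ {p} n {P : Fin n → Set p} → (∀ i → ¬ ¬ P i) → ¬ ¬ (∀ i → P i)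
  ¬¬-∀-Fin zero    ¬¬P ¬∀P = ¬∀P (λ ())
  ¬¬-∀-Fin (suc n) ¬¬P ¬∀P = ¬¬P zero (λ P₀ → ¬¬-∀-Fin n (¬¬P ∘ suc) (λ P₊ → ¬∀P (∀-cons P₀ P₊)))

  allOrCounterexample : ∀ {p} n (P : Fin n → Set p) → ¬ ¬ ((∀ i → P i) ⊎ ∃ λ i → ¬ P i)
  allOrCounterexample n P = ¬¬-map decide (¬¬-∀-Fin n (λ i → ¬¬-excluded-middle))
    where
    decide : (∀ i → Dec (P i)) → (∀ i → P i) ⊎ ∃ λ i → ¬ P i
    decide P? with all? P?
    ... | yes ∀P = inj₁ ∀P
    ... | no ¬∀P = inj₂ (¬∀⟶∃¬ n P P? ¬∀P)

  _⁻¹[_] : ∀ x → ¬ (x ≈ 0#) → Carrier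
  x ⁻¹[ x≉0 ] = proj₁ (inverse x x≉0)

  *-inverseʳ : ∀ x (x≉0 : ¬ (x ≈ 0#)) → x * x ⁻¹[ x≉0 ] ≈ 1#
  *-inverseʳ x x≉0 = proj₂ (inverse x x≉0)

  *-cancelˡ-≈0 : ∀ {p x} → ¬ (p ≈ 0#) → p * x ≈ 0# → x ≈ 0#
  *-cancelˡ-≈0 {p} {x} p≉0 px≈0 = begin
    x                              ≈⟨ *-identityˡ x ⟨
    1# * x                         ≈⟨ *-congʳ (trans (*-comm _ _) (*-inverseʳ p p≉0)) ⟨
    (p ⁻¹[ p≉0 ] * p) * x          ≈⟨ *-assoc _ _ _ ⟩
    p ⁻¹[ p≉0 ] * (p * x)          ≈⟨ *-zeroʳ-≈ _ px≈0 ⟩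
    0#                             ∎

  δ : ∀ {r} → Fin r → Fin r → Carrier
  δ a b with a ≟ᶠ b
  ... | yes _ = 1#
  ... | no  _ = 0#

  δ-refl : ∀ {r} (a : Fin r) → δ a a ≈ 1#
  δ-refl a with a ≟ᶠ a
  ... | yes _   = refl
  ... | no  a≢a = ⊥-elim (a≢a ≡.refl)

  δ-≢ : ∀ {r} {a b : Fin r} → a ≢ b → δ a b ≈ 0#
  δ-≢ {a = a} {b} a≢b with a ≟ᶠ b
  ... | yes a≡b = ⊥-elim (a≢b a≡b)
  ... | no  _   = refl

  δ-punchIn : ∀ {r} (a₀ : Fin (suc r)) (a b : Fin r) → δ (punchIn a₀ a) (punchIn a₀ b) ≈ δ a b
  δ-punchIn a₀ a b with a ≟ᶠ b
  ... | yes ≡.refl = δ-refl (punchIn a₀ a)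
  ... | no  a≢b    = δ-≢ (a≢b ∘ punchIn-injective a₀ a b)

  IdentityFactorsThrough : ℕ → ℕ → Set (c ⊔ ℓ)
  IdentityFactorsThrough r s =
    Σ (Fin r → Fin s → Carrier) λ α → Σ (Fin s → Fin r → Carrier) λ β → ∀ a b → sum (λ m → α a m * β m b) ≈ δ a b

  factorsThrough-dropZeroColumn : ∀ {r s} ((α , β , _) : IdentityFactorsThrough r (suc s)) →
                                  (∀ a → α a zero ≈ 0#) → IdentityFactorsThrough r s
  factorsThrough-dropZeroColumn (α , β , αβ≈δ) column₀≈0 =
    (λ a m → α a (suc m)) , (λ m b → β (suc m) b) ,
    (λ a b → trans (sym (trans (+-congʳ (*-zeroˡ-≈ (β zero b) (column₀≈0 a))) (+-identityˡ _))) (αβ≈δ a b))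

  -- Gaussian elimination of the pivot α a₀ 0, followed by deleting row a₀ and column 0.
  factorsThrough-pivot : ∀ {r s} ((α , β , _) : IdentityFactorsThrough (suc r) (suc s)) a₀ →
                         ¬ (α a₀ zero ≈ 0#) → IdentityFactorsThrough r s
  factorsThrough-pivot {r} {s} (α , β , αβ≈δ) a₀ p≉0 = α′ , β′ , α′β′≈δ
    where
    p = α a₀ zero
    q = p ⁻¹[ p≉0 ]
    coeff : Fin r → Carrier
    coeff a′ = α (punchIn a₀ a′) zero * q
    α′ : Fin r → Fin s → Carrier
    α′ a′ m = α (punchIn a₀ a′) (suc m) - coeff a′ * α a₀ (suc m)
    β′ : Fin s → Fin r → Carrier
    β′ m b′ = β (suc m) (punchIn a₀ b′)
    tail≈ : ∀ a b → sum (λ m → α a (suc m) * β (suc m) b) ≈ δ a b - α a zero * β zero b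
    tail≈ a b = begin
      sum (λ m → α a (suc m) * β (suc m) b)
        ≈⟨ solve 2 (λ x y → y := x :+ y :- x) refl (α a zero * β zero b) _ ⟩
      (α a zero * β zero b + sum (λ m → α a (suc m) * β (suc m) b)) - α a zero * β zero b
        ≈⟨ +-congʳ (αβ≈δ a b) ⟩
      δ a b - α a zero * β zero b ∎
    α′β′≈δ : ∀ a′ b′ → sum (λ m → α′ a′ m * β′ m b′) ≈ δ a′ b′
    α′β′≈δ a′ b′ = begin
      sum (λ m → α′ a′ m * β′ m b′)
        ≈⟨ sum-cong-≋ (λ m → solve 4 (λ x c y z → (x :- c :* y) :* z := x :* z :+ (:- c) :* (y :* z)) refl
                                      (α a (suc m)) (coeff a′) (α a₀ (suc m)) (β (suc m) b)) ⟩
      sum (λ m → α a (suc m) * β (suc m) b + (- coeff a′) * (α a₀ (suc m) * β (suc m) b))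
        ≈⟨ trans (∑-distrib-+ (λ m → α a (suc m) * β (suc m) b) (λ m → (- coeff a′) * (α a₀ (suc m) * β (suc m) b)))
                 (+-congˡ (sym (*-distribˡ-sum (- coeff a′) (λ m → α a₀ (suc m) * β (suc m) b)))) ⟩
      sum (λ m → α a (suc m) * β (suc m) b) + (- coeff a′) * sum (λ m → α a₀ (suc m) * β (suc m) b)
        ≈⟨ +-cong (tail≈ a b) (*-congˡ (tail≈ a₀ b)) ⟩
      (δ a b - α a zero * β zero b) + (- coeff a′) * (δ a₀ b - p * β zero b)
        ≈⟨ +-cong (+-congʳ (δ-punchIn a₀ a′ b′)) (*-congˡ (+-congʳ (δ-≢ (punchInᵢ≢i a₀ b′ ∘ ≡.sym)))) ⟩
      (δ a′ b′ - α a zero * β zero b) + (- coeff a′) * (0# - p * β zero b)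
        ≈⟨ solve 5 (λ d x y q p → (d :- x :* y) :+ (:- (x :* q)) :* (con (ℤ.+ 0) :- p :* y) := d :+ x :* y :* (q :* p :- con (ℤ.+ 1)))
                   refl (δ a′ b′) (α a zero) (β zero b) q p ⟩
      δ a′ b′ + α a zero * β zero b * (q * p - 1#)
        ≈⟨ +-congˡ (*-zeroʳ-≈ _ (trans (+-congʳ (trans (*-comm q p) (*-inverseʳ p p≉0))) (-‿inverseʳ 1#))) ⟩
      δ a′ b′ + 0#
        ≈⟨ +-identityʳ _ ⟩
      δ a′ b′ ∎
      where
      a = punchIn a₀ a′
      b = punchIn a₀ b′

  factorsThrough⇒≤ : ∀ r s → IdentityFactorsThrough r s → r ≤ s
  factorsThrough⇒≤ zero    s       _               = z≤n
  factorsThrough⇒≤ (suc r) zero    (α , β , αβ≈δ)  = ⊥-elim (1≉0 (trans (sym (δ-refl {suc r} zero)) (sym (αβ≈δ zero zero))))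
  factorsThrough⇒≤ (suc r) (suc s) f@(α , β , αβ≈δ) =
    decidable-stable (suc r ≤? suc s) (¬¬-map cases (allOrCounterexample (suc r) (λ a → α a zero ≈ 0#)))
    where
    cases : (∀ a → α a zero ≈ 0#) ⊎ ∃ (λ a → ¬ (α a zero ≈ 0#)) → suc r ≤ suc s
    cases (inj₁ column₀≈0)  = m≤n⇒m≤1+n (factorsThrough⇒≤ (suc r) s (factorsThrough-dropZeroColumn f column₀≈0))
    cases (inj₂ (a₀ , p≉0)) = s≤s (factorsThrough⇒≤ r s (factorsThrough-pivot f a₀ p≉0))

  record KernelVector {k} (M : Matrix k) : Set (c ⊔ ℓ) where
    constructor kernelVector
    field
      vector      : Fin k → Carrier
      support     : Fin k
      nonzero     : ¬ (vector support ≈ 0#)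
      annihilated : ∀ i → (M *ᵥ vector) i ≈ 0#

  zeroColumn⇒kernelVector : ∀ {k} (M : Matrix (suc k)) → (∀ i → M i zero ≈ 0#) → KernelVector M
  zeroColumn⇒kernelVector {k} M column₀≈0 = kernelVector e₀ zero 1≉0 annihilated
    where
    e₀ : Fin (suc k) → Carrier
    e₀ zero    = 1#
    e₀ (suc _) = 0#
    annihilated : ∀ i → (M *ᵥ e₀) i ≈ 0#
    annihilated i = trans (+-cong (*-zeroˡ-≈ 1# (column₀≈0 i)) (sum-zero (λ c → zeroʳ (M i (suc c))))) (+-identityˡ 0#)

  -- Clearing the pivot row r by column operations reduces the kernel problem to the minor at (r , 0).
  module Pivot {k} (M : Matrix (suc k)) (r : Fin (suc k)) (p≉0 : ¬ (M r zero ≈ 0#)) where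

    p q : Carrier
    p = M r zero
    q = p ⁻¹[ p≉0 ]

    t : Fin k → Carrier
    t c = M r (suc c) * q

    reduced : Matrix (suc k)
    reduced i zero    = M i zero
    reduced i (suc c) = M i (suc c) - t c * M i zero

    reduced-pivotRow : ∀ c → reduced r (suc c) ≈ 0#
    reduced-pivotRow c = begin
      M r (suc c) - (M r (suc c) * q) * p    ≈⟨ solve 3 (λ a q p → a :- (a :* q) :* p := a :- a :* (p :* q)) refl (M r (suc c)) q p ⟩
      M r (suc c) - M r (suc c) * (p * q)    ≈⟨ +-congˡ (-‿cong (trans (*-congˡ (*-inverseʳ p p≉0)) (*-identityʳ _))) ⟩
      M r (suc c) - M r (suc c)              ≈⟨ -‿inverseʳ _ ⟩
      0#                                     ∎

    det-reduced : det (suc k) reduced ≈ det (suc k) M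
    det-reduced = det-addFirstColumnMultiples M (λ c → - t c) {reduced} (λ i → refl) (λ i c → +-congˡ (-‿distribˡ-* (t c) (M i zero)))

    det-reduced-expansion : Σ Bool λ b → det (suc k) reduced ≈ sgn b (p * det k (minor r reduced))
    det-reduced-expansion = signedSum-single (suc k) true (λ i → reduced i zero * det k (minor i reduced)) r other≈0
      where
      other≈0 : ∀ i → i ≢ r → reduced i zero * det k (minor i reduced) ≈ 0#
      other≈0 i i≢r = *-zeroʳ-≈ _ (det-zeroRow k (punchOut i≢r) (minor i reduced) (λ c →
        trans (reflexive (≡.cong (λ z → reduced z (suc c)) (punchIn-punchOut i≢r))) (reduced-pivotRow c)))

    minor-singular : det (suc k) M ≈ 0# → det k (minor r reduced) ≈ 0#
    minor-singular det≈0 with det-reduced-expansion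
    ... | b , expansion = *-cancelˡ-≈0 p≉0 (sgn-zero⁻¹ b (trans (sym expansion) (trans det-reduced det≈0)))

    extend : KernelVector (minor r reduced) → KernelVector M
    extend (kernelVector v j vj≉0 v-annihilated) = kernelVector w (suc j) vj≉0 annihilated
      where
      w : Fin (suc k) → Carrier
      w zero    = - sum (λ c → t c * v c)
      w (suc c) = v c
      M*w≈reduced*v : ∀ i → (M *ᵥ w) i ≈ sum (λ c → reduced i (suc c) * v c)
      M*w≈reduced*v i = begin
        M i zero * - sum (λ c → t c * v c) + sum (λ c → M i (suc c) * v c)
          ≈⟨ solve 3 (λ m s u → m :* (:- s) :+ u := u :+ (:- m) :* s) refl (M i zero) (sum (λ c → t c * v c)) _ ⟩
        sum (λ c → M i (suc c) * v c) + (- M i zero) * sum (λ c → t c * v c)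
          ≈⟨ +-congˡ (*-distribˡ-sum (- M i zero) (λ c → t c * v c)) ⟩
        sum (λ c → M i (suc c) * v c) + sum (λ c → (- M i zero) * (t c * v c))
          ≈⟨ ∑-distrib-+ (λ c → M i (suc c) * v c) (λ c → (- M i zero) * (t c * v c)) ⟨
        sum (λ c → M i (suc c) * v c + (- M i zero) * (t c * v c))
          ≈⟨ sum-cong-≋ (λ c → solve 4 (λ a m t v → a :* v :+ (:- m) :* (t :* v) := (a :- t :* m) :* v) refl (M i (suc c)) (M i zero) (t c) (v c)) ⟩
        sum (λ c → reduced i (suc c) * v c) ∎
      annihilated : ∀ i → (M *ᵥ w) i ≈ 0#
      annihilated i with i ≟ᶠ r
      ... | yes ≡.refl = trans (M*w≈reduced*v i) (sum-zero (λ c → *-zeroˡ-≈ (v c) (reduced-pivotRow c)))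
      ... | no  i≢r    = trans (M*w≈reduced*v i) (trans
        (sum-cong-≋ (λ c → *-congʳ (reflexive (≡.cong (λ z → reduced z (suc c)) (≡.sym (punchIn-punchOut r≢i))))))
        (v-annihilated (punchOut r≢i)))
        where
        r≢i : r ≢ i
        r≢i = i≢r ∘ ≡.sym

  singular⇒kernelVector : ∀ k (M : Matrix k) → det k M ≈ 0# → ¬ ¬ KernelVector M
  singular⇒kernelVector zero    M det≈0 _    = 1≉0 det≈0
  singular⇒kernelVector (suc k) M det≈0 ¬ker = allOrCounterexample (suc k) (λ i → M i zero ≈ 0#) cases
    where
    cases : (∀ i → M i zero ≈ 0#) ⊎ ∃ (λ i → ¬ (M i zero ≈ 0#)) → ⊥
    cases (inj₁ column₀≈0) = ¬ker (zeroColumn⇒kernelVector M column₀≈0)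
    cases (inj₂ (r , p≉0)) = singular⇒kernelVector k (minor r reduced) (minor-singular det≈0) (¬ker ∘ extend)
      where open Pivot M r p≉0

-- R[ε, η] / (ε², η²), an element being c₀ + cε ε + cη η + cεη εη; the εη-coefficient of g (x + ε u + η w)
-- is the mixed second derivative of g at x in the directions u and w.
module Bidual {c ℓ} (R : CommutativeRing c ℓ) where

  open import Algebra.Structures using (IsCommutativeRing)
  open import Algebra.Morphism.Structures using (module RingMorphisms)
  open import Data.Bool using (true; false)
  open import Data.Fin using (Fin; suc)
  open import Data.Nat using (zero; suc)
  open import Data.Product using (_,_)
  open import Function using (_∘_)
  import Data.Integer as ℤ
  open CommutativeRing R hiding (zero)
  open FiniteSums R using (sum)
  open Determinant R using (signedSum)
  open import Algebra.Properties.Ring ring using (-0#≈0#)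
  open ℤ-CoefficientRingSolver R using (solve; _:=_; _:+_; _:*_; con)

  record Bidual : Set c where
    constructor bidual
    field
      c₀ cε cη cεη : Carrier
  open Bidual public

  infix 4 _≈ᴮ_
  record _≈ᴮ_ (x y : Bidual) : Set ℓ where
    constructor bidual≈
    field
      ≈c₀ : c₀ x ≈ c₀ y
      ≈cε : cε x ≈ cε y
      ≈cη : cη x ≈ cη y
      ≈cεη : cεη x ≈ cεη y
  open _≈ᴮ_ public

  infixl 6 _+ᴮ_
  infixl 7 _*ᴮ_

  _+ᴮ_ : Bidual → Bidual → Bidual
  x +ᴮ y = bidual (c₀ x + c₀ y) (cε x + cε y) (cη x + cη y) (cεη x + cεη y)

  _*ᴮ_ : Bidual → Bidual → Bidual
  x *ᴮ y = bidual (c₀ x * c₀ y) (c₀ x * cε y + cε x * c₀ y) (c₀ x * cη y + cη x * c₀ y)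
                  (c₀ x * cεη y + cε x * cη y + cη x * cε y + cεη x * c₀ y)

  -ᴮ_ : Bidual → Bidual
  -ᴮ x = bidual (- c₀ x) (- cε x) (- cη x) (- cεη x)

  0ᴮ 1ᴮ : Bidual
  0ᴮ = bidual 0# 0# 0# 0#
  1ᴮ = bidual 1# 0# 0# 0#

  isCommutativeRingᴮ : IsCommutativeRing _≈ᴮ_ _+ᴮ_ _*ᴮ_ -ᴮ_ 0ᴮ 1ᴮ
  isCommutativeRingᴮ = record
    { isRing = record
      { +-isAbelianGroup = record
        { isGroup = record
          { isMonoid = record
            { isSemigroup = record
              { isMagma = record
                { isEquivalence = record
                  { refl  = bidual≈ refl refl refl refl
                  ; sym   = λ p → bidual≈ (sym (≈c₀ p)) (sym (≈cε p)) (sym (≈cη p)) (sym (≈cεη p))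
                  ; trans = λ p q → bidual≈ (trans (≈c₀ p) (≈c₀ q)) (trans (≈cε p) (≈cε q)) (trans (≈cη p) (≈cη q)) (trans (≈cεη p) (≈cεη q))
                  }
                ; ∙-cong = λ p q → bidual≈ (+-cong (≈c₀ p) (≈c₀ q)) (+-cong (≈cε p) (≈cε q)) (+-cong (≈cη p) (≈cη q)) (+-cong (≈cεη p) (≈cεη q))
                }
              ; assoc = λ _ _ _ → bidual≈ (+-assoc _ _ _) (+-assoc _ _ _) (+-assoc _ _ _) (+-assoc _ _ _)
              }
            ; identity = (λ _ → bidual≈ (+-identityˡ _) (+-identityˡ _) (+-identityˡ _) (+-identityˡ _))
                       , (λ _ → bidual≈ (+-identityʳ _) (+-identityʳ _) (+-identityʳ _) (+-identityʳ _))
            }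
          ; inverse = (λ _ → bidual≈ (-‿inverseˡ _) (-‿inverseˡ _) (-‿inverseˡ _) (-‿inverseˡ _))
                    , (λ _ → bidual≈ (-‿inverseʳ _) (-‿inverseʳ _) (-‿inverseʳ _) (-‿inverseʳ _))
          ; ⁻¹-cong = λ p → bidual≈ (-‿cong (≈c₀ p)) (-‿cong (≈cε p)) (-‿cong (≈cη p)) (-‿cong (≈cεη p))
          }
        ; comm = λ _ _ → bidual≈ (+-comm _ _) (+-comm _ _) (+-comm _ _) (+-comm _ _)
        }
      ; *-cong = λ p q → bidual≈ (*-cong (≈c₀ p) (≈c₀ q))
          (+-cong (*-cong (≈c₀ p) (≈cε q)) (*-cong (≈cε p) (≈c₀ q)))
          (+-cong (*-cong (≈c₀ p) (≈cη q)) (*-cong (≈cη p) (≈c₀ q)))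
          (+-cong (+-cong (+-cong (*-cong (≈c₀ p) (≈cεη q)) (*-cong (≈cε p) (≈cη q))) (*-cong (≈cη p) (≈cε q))) (*-cong (≈cεη p) (≈c₀ q)))
      ; *-assoc = λ x y z → bidual≈ (*-assoc _ _ _)
          (first-order-assoc (c₀ x) (cε x) (c₀ y) (cε y) (c₀ z) (cε z))
          (first-order-assoc (c₀ x) (cη x) (c₀ y) (cη y) (c₀ z) (cη z))
          (solve 12 (λ a₀ a₁ a₂ a₃ b₀ b₁ b₂ b₃ d₀ d₁ d₂ d₃ →
              (a₀ :* b₀) :* d₃ :+ (a₀ :* b₁ :+ a₁ :* b₀) :* d₂ :+ (a₀ :* b₂ :+ a₂ :* b₀) :* d₁
                :+ (a₀ :* b₃ :+ a₁ :* b₂ :+ a₂ :* b₁ :+ a₃ :* b₀) :* d₀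
              := a₀ :* (b₀ :* d₃ :+ b₁ :* d₂ :+ b₂ :* d₁ :+ b₃ :* d₀) :+ a₁ :* (b₀ :* d₂ :+ b₂ :* d₀)
                :+ a₂ :* (b₀ :* d₁ :+ b₁ :* d₀) :+ a₃ :* (b₀ :* d₀))
             refl (c₀ x) (cε x) (cη x) (cεη x) (c₀ y) (cε y) (cη y) (cεη y) (c₀ z) (cε z) (cη z) (cεη z))
      ; *-identity = (λ x → bidual≈ (*-identityˡ _)
                       (solve 2 (λ a b → con (ℤ.+ 1) :* b :+ con (ℤ.+ 0) :* a := b) refl (c₀ x) (cε x))
                       (solve 2 (λ a b → con (ℤ.+ 1) :* b :+ con (ℤ.+ 0) :* a := b) refl (c₀ x) (cη x))
                       (solve 4 (λ a b d e → con (ℤ.+ 1) :* e :+ con (ℤ.+ 0) :* d :+ con (ℤ.+ 0) :* b :+ con (ℤ.+ 0) :* a := e)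
                              refl (c₀ x) (cε x) (cη x) (cεη x)))
                   , (λ x → bidual≈ (*-identityʳ _)
                       (solve 2 (λ a b → a :* con (ℤ.+ 0) :+ b :* con (ℤ.+ 1) := b) refl (c₀ x) (cε x))
                       (solve 2 (λ a b → a :* con (ℤ.+ 0) :+ b :* con (ℤ.+ 1) := b) refl (c₀ x) (cη x))
                       (solve 4 (λ a b d e → a :* con (ℤ.+ 0) :+ b :* con (ℤ.+ 0) :+ d :* con (ℤ.+ 0) :+ e :* con (ℤ.+ 1) := e)
                              refl (c₀ x) (cε x) (cη x) (cεη x)))
      ; distrib = (λ x y z → bidual≈ (distribˡ _ _ _)
                     (first-order-distribˡ (c₀ x) (cε x) (c₀ y) (cε y) (c₀ z) (cε z))
                     (first-order-distribˡ (c₀ x) (cη x) (c₀ y) (cη y) (c₀ z) (cη z))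
                     (solve 12 (λ a₀ a₁ a₂ a₃ b₀ b₁ b₂ b₃ d₀ d₁ d₂ d₃ →
                         a₀ :* (b₃ :+ d₃) :+ a₁ :* (b₂ :+ d₂) :+ a₂ :* (b₁ :+ d₁) :+ a₃ :* (b₀ :+ d₀)
                         := (a₀ :* b₃ :+ a₁ :* b₂ :+ a₂ :* b₁ :+ a₃ :* b₀) :+ (a₀ :* d₃ :+ a₁ :* d₂ :+ a₂ :* d₁ :+ a₃ :* d₀))
                        refl (c₀ x) (cε x) (cη x) (cεη x) (c₀ y) (cε y) (cη y) (cεη y) (c₀ z) (cε z) (cη z) (cεη z)))
                , (λ x y z → bidual≈ (distribʳ _ _ _)
                     (first-order-distribʳ (c₀ x) (cε x) (c₀ y) (cε y) (c₀ z) (cε z))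
                     (first-order-distribʳ (c₀ x) (cη x) (c₀ y) (cη y) (c₀ z) (cη z))
                     (solve 12 (λ a₀ a₁ a₂ a₃ b₀ b₁ b₂ b₃ d₀ d₁ d₂ d₃ →
                         (b₀ :+ d₀) :* a₃ :+ (b₁ :+ d₁) :* a₂ :+ (b₂ :+ d₂) :* a₁ :+ (b₃ :+ d₃) :* a₀
                         := (b₀ :* a₃ :+ b₁ :* a₂ :+ b₂ :* a₁ :+ b₃ :* a₀) :+ (d₀ :* a₃ :+ d₁ :* a₂ :+ d₂ :* a₁ :+ d₃ :* a₀))
                        refl (c₀ x) (cε x) (cη x) (cεη x) (c₀ y) (cε y) (cη y) (cεη y) (c₀ z) (cε z) (cη z) (cεη z)))
      }
    ; *-comm = λ x y → bidual≈ (*-comm _ _)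
        (first-order-comm (c₀ x) (cε x) (c₀ y) (cε y))
        (first-order-comm (c₀ x) (cη x) (c₀ y) (cη y))
        (solve 8 (λ a₀ a₁ a₂ a₃ b₀ b₁ b₂ b₃ → a₀ :* b₃ :+ a₁ :* b₂ :+ a₂ :* b₁ :+ a₃ :* b₀ := b₀ :* a₃ :+ b₁ :* a₂ :+ b₂ :* a₁ :+ b₃ :* a₀)
           refl (c₀ x) (cε x) (cη x) (cεη x) (c₀ y) (cε y) (cη y) (cεη y))
    }
    where
    first-order-assoc : ∀ a₀ a₁ b₀ b₁ d₀ d₁ → (a₀ * b₀) * d₁ + (a₀ * b₁ + a₁ * b₀) * d₀ ≈ a₀ * (b₀ * d₁ + b₁ * d₀) + a₁ * (b₀ * d₀)
    first-order-assoc = solve 6 (λ a₀ a₁ b₀ b₁ d₀ d₁ →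
      (a₀ :* b₀) :* d₁ :+ (a₀ :* b₁ :+ a₁ :* b₀) :* d₀ := a₀ :* (b₀ :* d₁ :+ b₁ :* d₀) :+ a₁ :* (b₀ :* d₀)) refl
    first-order-distribˡ : ∀ a₀ a₁ b₀ b₁ d₀ d₁ → a₀ * (b₁ + d₁) + a₁ * (b₀ + d₀) ≈ (a₀ * b₁ + a₁ * b₀) + (a₀ * d₁ + a₁ * d₀)
    first-order-distribˡ = solve 6 (λ a₀ a₁ b₀ b₁ d₀ d₁ →
      a₀ :* (b₁ :+ d₁) :+ a₁ :* (b₀ :+ d₀) := (a₀ :* b₁ :+ a₁ :* b₀) :+ (a₀ :* d₁ :+ a₁ :* d₀)) refl
    first-order-distribʳ : ∀ a₀ a₁ b₀ b₁ d₀ d₁ → (b₀ + d₀) * a₁ + (b₁ + d₁) * a₀ ≈ (b₀ * a₁ + b₁ * a₀) + (d₀ * a₁ + d₁ * a₀)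
    first-order-distribʳ = solve 6 (λ a₀ a₁ b₀ b₁ d₀ d₁ →
      (b₀ :+ d₀) :* a₁ :+ (b₁ :+ d₁) :* a₀ := (b₀ :* a₁ :+ b₁ :* a₀) :+ (d₀ :* a₁ :+ d₁ :* a₀)) refl
    first-order-comm : ∀ a₀ a₁ b₀ b₁ → a₀ * b₁ + a₁ * b₀ ≈ b₀ * a₁ + b₁ * a₀
    first-order-comm = solve 4 (λ a₀ a₁ b₀ b₁ → a₀ :* b₁ :+ a₁ :* b₀ := b₀ :* a₁ :+ b₁ :* a₀) refl

  commutativeRingᴮ : CommutativeRing c ℓ
  commutativeRingᴮ = record { isCommutativeRing = isCommutativeRingᴮ }

  open RingMorphisms using (IsRingHomomorphism)

  constant : Carrier → Bidual
  constant x = bidual x 0# 0# 0#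

  constant-*ᴮ : ∀ x y → constant x *ᴮ y ≈ᴮ bidual (x * c₀ y) (x * cε y) (x * cη y) (x * cεη y)
  constant-*ᴮ x y = bidual≈ refl
    (solve 3 (λ x a b → x :* b :+ con (ℤ.+ 0) :* a := x :* b) refl x (c₀ y) (cε y))
    (solve 3 (λ x a b → x :* b :+ con (ℤ.+ 0) :* a := x :* b) refl x (c₀ y) (cη y))
    (solve 5 (λ x a b d e → x :* e :+ con (ℤ.+ 0) :* d :+ con (ℤ.+ 0) :* b :+ con (ℤ.+ 0) :* a := x :* e) refl x (c₀ y) (cε y) (cη y) (cεη y))

  constant-isRingHomomorphism : IsRingHomomorphism rawRing (CommutativeRing.rawRing commutativeRingᴮ) constant
  constant-isRingHomomorphism = mkIsRingHomomorphism R commutativeRingᴮ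
    (λ x≈y → bidual≈ x≈y refl refl refl)
    (λ _ _ → bidual≈ refl (sym (+-identityˡ 0#)) (sym (+-identityˡ 0#)) (sym (+-identityˡ 0#)))
    (λ x y → bidual≈ refl
      (solve 2 (λ a b → con (ℤ.+ 0) := a :* con (ℤ.+ 0) :+ con (ℤ.+ 0) :* b) refl x y)
      (solve 2 (λ a b → con (ℤ.+ 0) := a :* con (ℤ.+ 0) :+ con (ℤ.+ 0) :* b) refl x y)
      (solve 2 (λ a b → con (ℤ.+ 0) := a :* con (ℤ.+ 0) :+ con (ℤ.+ 0) :* con (ℤ.+ 0) :+ con (ℤ.+ 0) :* con (ℤ.+ 0) :+ con (ℤ.+ 0) :* b) refl x y))
    (λ _ → bidual≈ refl (sym -0#≈0#) (sym -0#≈0#) (sym -0#≈0#))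
    (bidual≈ refl refl refl refl)
    (bidual≈ refl refl refl refl)

  c₀-isRingHomomorphism : IsRingHomomorphism (CommutativeRing.rawRing commutativeRingᴮ) rawRing c₀
  c₀-isRingHomomorphism = mkIsRingHomomorphism commutativeRingᴮ R ≈c₀ (λ _ _ → refl) (λ _ _ → refl) (λ _ → refl) refl refl

  dropε dropη : Bidual → Bidual
  dropε x = bidual (c₀ x) 0# (cη x) 0#
  dropη x = bidual (c₀ x) (cε x) 0# 0#

  dropε-isRingHomomorphism : IsRingHomomorphism (CommutativeRing.rawRing commutativeRingᴮ) (CommutativeRing.rawRing commutativeRingᴮ) dropε
  dropε-isRingHomomorphism = mkIsRingHomomorphism commutativeRingᴮ commutativeRingᴮ
    (λ p → bidual≈ (≈c₀ p) refl (≈cη p) refl)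
    (λ _ _ → bidual≈ refl (sym (+-identityˡ 0#)) refl (sym (+-identityˡ 0#)))
    (λ x y → bidual≈ refl
      (solve 2 (λ a b → con (ℤ.+ 0) := a :* con (ℤ.+ 0) :+ con (ℤ.+ 0) :* b) refl (c₀ x) (c₀ y))
      refl
      (solve 4 (λ a b d e → con (ℤ.+ 0) := a :* con (ℤ.+ 0) :+ con (ℤ.+ 0) :* e :+ d :* con (ℤ.+ 0) :+ con (ℤ.+ 0) :* b)
             refl (c₀ x) (c₀ y) (cη x) (cη y)))
    (λ _ → bidual≈ refl (sym -0#≈0#) refl (sym -0#≈0#))
    (bidual≈ refl refl refl refl)
    (bidual≈ refl refl refl refl)

  dropη-isRingHomomorphism : IsRingHomomorphism (CommutativeRing.rawRing commutativeRingᴮ) (CommutativeRing.rawRing commutativeRingᴮ) dropη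
  dropη-isRingHomomorphism = mkIsRingHomomorphism commutativeRingᴮ commutativeRingᴮ
    (λ p → bidual≈ (≈c₀ p) (≈cε p) refl refl)
    (λ _ _ → bidual≈ refl refl (sym (+-identityˡ 0#)) (sym (+-identityˡ 0#)))
    (λ x y → bidual≈ refl refl
      (solve 2 (λ a b → con (ℤ.+ 0) := a :* con (ℤ.+ 0) :+ con (ℤ.+ 0) :* b) refl (c₀ x) (c₀ y))
      (solve 4 (λ a b d e → con (ℤ.+ 0) := a :* con (ℤ.+ 0) :+ d :* con (ℤ.+ 0) :+ con (ℤ.+ 0) :* e :+ con (ℤ.+ 0) :* b)
             refl (c₀ x) (c₀ y) (cε x) (cε y)))
    (λ _ → bidual≈ refl refl (sym -0#≈0#) (sym -0#≈0#))
    (bidual≈ refl refl refl refl)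
    (bidual≈ refl refl refl refl)

  module ᴮ where
    open CommutativeRing commutativeRingᴮ public
    open Determinant commutativeRingᴮ public

  sumᴮ-components : ∀ {m} (f : Fin m → Bidual) → ᴮ.sum f ≈ᴮ bidual (sum (c₀ ∘ f)) (sum (cε ∘ f)) (sum (cη ∘ f)) (sum (cεη ∘ f))
  sumᴮ-components {zero}  f = bidual≈ refl refl refl refl
  sumᴮ-components {suc m} f = bidual≈ (+-congˡ (≈c₀ rest)) (+-congˡ (≈cε rest)) (+-congˡ (≈cη rest)) (+-congˡ (≈cεη rest))
    where rest = sumᴮ-components (f ∘ suc)

  cεη-signedSum : ∀ m s (f : Fin m → Bidual) → cεη (ᴮ.signedSum m s f) ≈ signedSum m s (cεη ∘ f)
  cεη-signedSum zero    s     f = refl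
  cεη-signedSum (suc m) true  f = +-congˡ (cεη-signedSum m false (f ∘ suc))
  cεη-signedSum (suc m) false f = +-congˡ (cεη-signedSum m true (f ∘ suc))

  firstOrder-* : ∀ a a′ b b′ → bidual 0# a b 0# *ᴮ bidual 0# a′ b′ 0# ≈ᴮ bidual 0# 0# 0# (a * b′ + b * a′)
  firstOrder-* a a′ b b′ = bidual≈ (zeroˡ 0#)
    (solve 2 (λ a a′ → con (ℤ.+ 0) :* a′ :+ a :* con (ℤ.+ 0) := con (ℤ.+ 0)) refl a a′)
    (solve 2 (λ b b′ → con (ℤ.+ 0) :* b′ :+ b :* con (ℤ.+ 0) := con (ℤ.+ 0)) refl b b′)
    (solve 4 (λ a a′ b b′ → con (ℤ.+ 0) :* con (ℤ.+ 0) :+ a :* b′ :+ b :* a′ :+ con (ℤ.+ 0) :* con (ℤ.+ 0) := a :* b′ :+ b :* a′)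
           refl a a′ b b′)

  noFirstOrder-* : ∀ a a′ b b′ → bidual a 0# 0# a′ *ᴮ bidual b 0# 0# b′ ≈ᴮ bidual (a * b) 0# 0# (a * b′ + a′ * b)
  noFirstOrder-* a a′ b b′ = bidual≈ refl
    (solve 2 (λ a b → a :* con (ℤ.+ 0) :+ con (ℤ.+ 0) :* b := con (ℤ.+ 0)) refl a b)
    (solve 2 (λ a b → a :* con (ℤ.+ 0) :+ con (ℤ.+ 0) :* b := con (ℤ.+ 0)) refl a b)
    (solve 4 (λ a a′ b b′ → a :* b′ :+ con (ℤ.+ 0) :* con (ℤ.+ 0) :+ con (ℤ.+ 0) :* con (ℤ.+ 0) :+ a′ :* b := a :* b′ :+ a′ :* b)
           refl a a′ b b′)

module Hessian {c ℓ} (R : CommutativeRing c ℓ) where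

  open import Data.Bool using (true)
  open import Data.Fin using (Fin; zero; suc)
  open import Data.Nat using (suc)
  open import Function using (_∘_)
  import Data.Integer as ℤ

  open CommutativeRing R hiding (zero)
  open Determinant R
  open Bidual R
  open ℤ-CoefficientRingSolver R using (solve; _:=_; _:+_; _:*_; con)
  open import Relation.Binary.Reasoning.Setoid setoid

  perturbed : ∀ {k} → Matrix k → Matrix k → Matrix k → ᴮ.Matrix k
  perturbed M₀ U W i j = bidual (M₀ i j) (U i j) (W i j) 0#

  𝟘 : ∀ {k} → Matrix k
  𝟘 i j = 0#

  hessian : ∀ k → Matrix k → Matrix k → Matrix k → Carrier
  hessian k M₀ U W = cεη (ᴮ.det k (perturbed M₀ U W))

  ∂ε-minor : ∀ k → Matrix (suc k) → Matrix (suc k) → Fin (suc k) → Carrier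
  ∂ε-minor k M₀ U i = cε (ᴮ.det k (ᴮ.minor i (perturbed M₀ U 𝟘)))

  ∂η-minor : ∀ k → Matrix (suc k) → Matrix (suc k) → Fin (suc k) → Carrier
  ∂η-minor k M₀ W i = cη (ᴮ.det k (ᴮ.minor i (perturbed M₀ 𝟘 W)))

  cε-det-perturbed : ∀ k (M₀ U W : Matrix k) → cε (ᴮ.det k (perturbed M₀ U W)) ≈ cε (ᴮ.det k (perturbed M₀ U 𝟘))
  cε-det-perturbed k M₀ U W = ≈cε (det-homo commutativeRingᴮ commutativeRingᴮ dropη-isRingHomomorphism k (perturbed M₀ U W))

  cη-det-perturbed : ∀ k (M₀ U W : Matrix k) → cη (ᴮ.det k (perturbed M₀ U W)) ≈ cη (ᴮ.det k (perturbed M₀ 𝟘 W))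
  cη-det-perturbed k M₀ U W = ≈cη (det-homo commutativeRingᴮ commutativeRingᴮ dropε-isRingHomomorphism k (perturbed M₀ U W))

  perturbed-*ᵥ-constant : ∀ {k} (M₀ U W : Matrix k) w i →
    (perturbed M₀ U W ᴮ.*ᵥ (constant ∘ w)) i ≈ᴮ bidual ((M₀ *ᵥ w) i) ((U *ᵥ w) i) ((W *ᵥ w) i) 0#
  perturbed-*ᵥ-constant M₀ U W w i = ᴮ.trans (sumᴮ-components (λ c → perturbed M₀ U W i c *ᴮ constant (w c)))
    (bidual≈ refl (sum-cong-≋ (λ c → linear (M₀ i c) (U i c) (w c))) (sum-cong-≋ (λ c → linear (M₀ i c) (W i c) (w c)))
             (sum-zero (λ c → quadratic (M₀ i c) (U i c) (W i c) (w c))))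
    where
    linear : ∀ a b x → a * 0# + b * x ≈ b * x
    linear = solve 3 (λ a b x → a :* con (ℤ.+ 0) :+ b :* x := b :* x) refl
    quadratic : ∀ a b d x → a * 0# + b * 0# + d * 0# + 0# * x ≈ 0#
    quadratic = solve 4 (λ a b d x → a :* con (ℤ.+ 0) :+ b :* con (ℤ.+ 0) :+ d :* con (ℤ.+ 0) :+ con (ℤ.+ 0) :* x := con (ℤ.+ 0)) refl

  -- Cramer's rule puts M₀ w = 0 into the first column, which then has no constant term.
  hessian-kernelExpansion : ∀ k (M₀ : Matrix (suc k)) w → (∀ i → (M₀ *ᵥ w) i ≈ 0#) → ∀ U W →
    w zero * hessian (suc k) M₀ U W ≈ signedSum (suc k) true (λ i → (U *ᵥ w) i * ∂η-minor k M₀ W i + ∂ε-minor k M₀ U i * (W *ᵥ w) i)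
  hessian-kernelExpansion k M₀ w M₀w≈0 U W = begin
    w zero * cεη (ᴮ.det (suc k) N)
      ≈⟨ ≈cεη (constant-*ᴮ (w zero) (ᴮ.det (suc k) N)) ⟨
    cεη (constant (w zero) *ᴮ ᴮ.det (suc k) N)
      ≈⟨ ≈cεη (ᴮ.det-replaceColumn-*ᵥ (suc k) zero N (constant ∘ w)) ⟨
    cεη (ᴮ.det (suc k) (ᴮ.replaceColumn zero (N ᴮ.*ᵥ (constant ∘ w)) N))
      ≈⟨ ≈cεη (ᴮ.det-replaceColumn₀ k (N ᴮ.*ᵥ (constant ∘ w)) N) ⟩
    cεη (ᴮ.signedSum (suc k) true (λ i → (N ᴮ.*ᵥ (constant ∘ w)) i *ᴮ ᴮ.det k (ᴮ.minor i N)))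
      ≈⟨ cεη-signedSum (suc k) true (λ i → (N ᴮ.*ᵥ (constant ∘ w)) i *ᴮ ᴮ.det k (ᴮ.minor i N)) ⟩
    signedSum (suc k) true (λ i → cεη ((N ᴮ.*ᵥ (constant ∘ w)) i *ᴮ ᴮ.det k (ᴮ.minor i N)))
      ≈⟨ signedSum-cong (suc k) true term ⟩
    signedSum (suc k) true (λ i → (U *ᵥ w) i * ∂η-minor k M₀ W i + ∂ε-minor k M₀ U i * (W *ᵥ w) i) ∎
    where
    N = perturbed M₀ U W
    term : ∀ i → cεη ((N ᴮ.*ᵥ (constant ∘ w)) i *ᴮ ᴮ.det k (ᴮ.minor i N))
                 ≈ (U *ᵥ w) i * ∂η-minor k M₀ W i + ∂ε-minor k M₀ U i * (W *ᵥ w) i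
    term i = begin
      cεη (Nw *ᴮ D)
        ≈⟨ ≈cεη (ᴮ.*-congʳ (ᴮ.trans (perturbed-*ᵥ-constant M₀ U W w i) (bidual≈ (M₀w≈0 i) refl refl refl))) ⟩
      0# * cεη D + (U *ᵥ w) i * cη D + (W *ᵥ w) i * cε D + 0# * c₀ D
        ≈⟨ solve 6 (λ d₀ d₁ d₂ d₃ u v → con (ℤ.+ 0) :* d₃ :+ u :* d₂ :+ v :* d₁ :+ con (ℤ.+ 0) :* d₀ := u :* d₂ :+ d₁ :* v)
                   refl (c₀ D) (cε D) (cη D) (cεη D) ((U *ᵥ w) i) ((W *ᵥ w) i) ⟩
      (U *ᵥ w) i * cη D + cε D * (W *ᵥ w) i
        ≈⟨ +-cong (*-congˡ (cη-det-perturbed k _ _ _)) (*-congʳ (cε-det-perturbed k _ _ _)) ⟩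
      (U *ᵥ w) i * ∂η-minor k M₀ W i + ∂ε-minor k M₀ U i * (W *ᵥ w) i ∎
      where
      Nw = (N ᴮ.*ᵥ (constant ∘ w)) i
      D = ᴮ.det k (ᴮ.minor i N)

module HessianRankBound {c ℓ} (F : Field c ℓ) where

  open import Data.Bool using (true)
  open import Data.Product using (_,_)
  open import Data.Empty using (⊥-elim)
  open import Data.Fin using (Fin; zero; suc)
  open import Data.Fin.Properties using (suc-injective)
  open import Data.Nat using (zero; suc; _≤_; _≤?_) renaming (_+_ to _+ℕ_)
  open import Data.Vec.Functional using (_++_)
  open import Function using (_∘_)
  open import Level using (_⊔_)
  open import Relation.Binary.PropositionalEquality as ≡ using (_≢_)
  open import Relation.Nullary using (¬_; Dec; yes; no)
  open import Relation.Nullary.Decidable using (decidable-stable; ¬¬-excluded-middle)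

  open Field F hiding (zero)
  open Determinant commutativeRing
  open FieldLinearAlgebra F
  open Bidual commutativeRing
  open Hessian commutativeRing
  open ℤ-CoefficientRingSolver commutativeRing using (solve; _:=_; _:+_; _:*_; :-_)
  open import Algebra.Properties.Ring ring using (-‿involutive; -0#≈0#)
  open import Relation.Binary.Reasoning.Setoid setoid

  addColumn₀ : ∀ {k} → Fin (suc k) → Matrix (suc k) → Matrix (suc k)
  addColumn₀ j N = replaceColumn j (λ i → N i j + N i zero) N

  hessian-addColumn₀ : ∀ k (j : Fin (suc k)) → j ≢ zero → ∀ M₀ U W →
                       hessian (suc k) M₀ U W ≈ hessian (suc k) (addColumn₀ j M₀) (addColumn₀ j U) (addColumn₀ j W)
  hessian-addColumn₀ k j j≢0 M₀ U W = ≈cεη (ᴮ.sym (ᴮ.det-addColumnMultiple (suc k) j zero j≢0 1ᴮ agrees added))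
    where
    agrees : ᴮ.AgreeOff j (perturbed (addColumn₀ j M₀) (addColumn₀ j U) (addColumn₀ j W)) (perturbed M₀ U W)
    agrees i c c≢j = bidual≈ (replaceColumn-agreeOff j _ M₀ i c c≢j) (replaceColumn-agreeOff j _ U i c c≢j)
                             (replaceColumn-agreeOff j _ W i c c≢j) refl
    added : ∀ i → perturbed (addColumn₀ j M₀) (addColumn₀ j U) (addColumn₀ j W) i j ≈ᴮ
                  perturbed M₀ U W i j +ᴮ 1ᴮ *ᴮ perturbed M₀ U W i zero
    added i = ᴮ.trans (bidual≈ (replaceColumn-at j _ M₀ i) (replaceColumn-at j _ U i) (replaceColumn-at j _ W i) (sym (+-identityˡ 0#)))
                      (ᴮ.+-congˡ (ᴮ.sym (ᴮ.*-identityˡ _)))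

  record NormalizedKernelVector {k} (M₀ : Matrix (suc k)) : Set (c ⊔ ℓ) where
    field
      transform          : Matrix (suc k) → Matrix (suc k)
      vector             : Fin (suc k) → Carrier
      vector₀≉0          : ¬ (vector zero ≈ 0#)
      annihilated        : ∀ i → (transform M₀ *ᵥ vector) i ≈ 0#
      hessian-invariant  : ∀ U W → hessian (suc k) M₀ U W ≈ hessian (suc k) (transform M₀) (transform U) (transform W)

  -- If the kernel vector vanishes at 0 but not at j, adding column 0 to column j moves its support to 0.
  normalize : ∀ {k} {M₀ : Matrix (suc k)} (ker : KernelVector M₀) → Dec (KernelVector.vector ker zero ≈ 0#) → NormalizedKernelVector M₀
  normalize (kernelVector w j wj≉0 Mw≈0) (no w₀≉0) = record
    { transform = λ N → N ; vector = w ; vector₀≉0 = w₀≉0 ; annihilated = Mw≈0 ; hessian-invariant = λ _ _ → refl }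
  normalize (kernelVector w zero w₀≉0 Mw≈0) (yes w₀≈0) = ⊥-elim (w₀≉0 w₀≈0)
  normalize {k} {M₀} (kernelVector w (suc j) wj≉0 Mw≈0) (yes w₀≈0) = record
    { transform = addColumn₀ (suc j)
    ; vector = w′
    ; vector₀≉0 = λ w′₀≈0 → wj≉0 (trans (sym (-‿involutive _)) (trans (-‿cong w′₀≈0) -0#≈0#))
    ; annihilated = annihilated
    ; hessian-invariant = hessian-addColumn₀ k (suc j) (λ ()) M₀
    }
    where
    w′ : Fin (suc k) → Carrier
    w′ zero    = - w (suc j)
    w′ (suc c) = w (suc c)
    T = addColumn₀ (suc j) M₀
    tail≈ : ∀ i → sum (λ c → T i (suc c) * w (suc c)) ≈ sum (λ c → M₀ i (suc c) * w (suc c)) + M₀ i zero * w (suc j)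
    tail≈ i = sum-update _ _ j (M₀ i zero * w (suc j))
      (λ c c≢j → *-congʳ (replaceColumn-agreeOff (suc j) _ M₀ i (suc c) (c≢j ∘ suc-injective)))
      (trans (*-congʳ (replaceColumn-at (suc j) _ M₀ i)) (distribʳ _ _ _))
    annihilated : ∀ i → (T *ᵥ w′) i ≈ 0#
    annihilated i = begin
      T i zero * - w (suc j) + sum (λ c → T i (suc c) * w (suc c))
        ≈⟨ +-cong (*-congʳ (replaceColumn-agreeOff (suc j) (λ i → M₀ i (suc j) + M₀ i zero) M₀ i zero (λ ()))) (tail≈ i) ⟩
      M₀ i zero * - w (suc j) + (sum (λ c → M₀ i (suc c) * w (suc c)) + M₀ i zero * w (suc j))
        ≈⟨ solve 3 (λ m x s → m :* (:- x) :+ (s :+ m :* x) := s) refl (M₀ i zero) (w (suc j)) _ ⟩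
      sum (λ c → M₀ i (suc c) * w (suc c))
        ≈⟨ trans (+-congʳ (*-zeroʳ-≈ (M₀ i zero) w₀≈0)) (+-identityˡ _) ⟨
      (M₀ *ᵥ w) i
        ≈⟨ Mw≈0 i ⟩
      0# ∎

  hessianIdentity⇒factorization : ∀ {k} {M₀ : Matrix (suc k)} → NormalizedKernelVector M₀ →
    ∀ {r} (U W : Fin r → Matrix (suc k)) κ → (∀ a b → κ * hessian (suc k) M₀ (U a) (W b) ≈ δ a b) →
    IdentityFactorsThrough r (suc k +ℕ suc k)
  hessianIdentity⇒factorization {k} {M₀} nk {r} U W κ κH≈δ = α , β , αβ≈δ
    where
    open NormalizedKernelVector nk renaming (transform to T; vector to w)
    M₁ = T M₀
    w₀⁻¹ = w zero ⁻¹[ vector₀≉0 ]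
    ρ = κ * w₀⁻¹
    Uw ∂U : Fin r → Fin (suc k) → Carrier
    Uw a = T (U a) *ᵥ w
    ∂U a = ∂ε-minor k M₁ (T (U a))
    Ww ∂W : Fin r → Fin (suc k) → Carrier
    Ww b = T (W b) *ᵥ w
    ∂W b = ∂η-minor k M₁ (T (W b))
    α : Fin r → Fin (suc k +ℕ suc k) → Carrier
    α a = (λ i → ρ * sgn (parity true i) (Uw a i)) ++ (λ i → ρ * sgn (parity true i) (∂U a i))
    β : Fin (suc k +ℕ suc k) → Fin r → Carrier
    β m b = (∂W b ++ Ww b) m
    αβ≈δ : ∀ a b → sum (λ m → α a m * β m b) ≈ δ a b
    αβ≈δ a b = begin
      sum (λ m → α a m * β m b)
        ≈⟨ *-signedSum≈sum-++ ρ (Uw a) (∂W b) (∂U a) (Ww b) ⟨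
      ρ * signedSum (suc k) true (λ i → Uw a i * ∂W b i + ∂U a i * Ww b i)
        ≈⟨ *-congˡ (hessian-kernelExpansion k M₁ w annihilated (T (U a)) (T (W b))) ⟨
      (κ * w₀⁻¹) * (w zero * H₁)
        ≈⟨ solve 4 (λ κ q w h → (κ :* q) :* (w :* h) := κ :* h :* (w :* q)) refl κ w₀⁻¹ (w zero) H₁ ⟩
      κ * H₁ * (w zero * w₀⁻¹)
        ≈⟨ trans (*-congˡ (*-inverseʳ (w zero) vector₀≉0)) (*-identityʳ _) ⟩
      κ * H₁
        ≈⟨ *-congˡ (hessian-invariant (U a) (W b)) ⟨
      κ * hessian (suc k) M₀ (U a) (W b)
        ≈⟨ κH≈δ a b ⟩
      δ a b ∎
      where
      H₁ = hessian (suc k) M₁ (T (U a)) (T (W b))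

  hessianRank≤2k : ∀ k (M₀ : Matrix k) → det k M₀ ≈ 0# → ∀ {r} (U W : Fin r → Matrix k) κ →
                   (∀ a b → κ * hessian k M₀ (U a) (W b) ≈ δ a b) → r ≤ k +ℕ k
  hessianRank≤2k zero    M₀ det≈0 U W κ κH≈δ = ⊥-elim (1≉0 det≈0)
  hessianRank≤2k (suc k) M₀ det≈0 {r} U W κ κH≈δ = decidable-stable (r ≤? suc k +ℕ suc k) (λ r≰2k →
    singular⇒kernelVector (suc k) M₀ det≈0 (λ ker →
      ¬¬-excluded-middle (λ w₀≈0? →
        r≰2k (factorsThrough⇒≤ r (suc k +ℕ suc k) (hessianIdentity⇒factorization (normalize ker w₀≈0?) U W κ κH≈δ)))))

module SchurComplement {c ℓ} (R : CommutativeRing c ℓ) where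

  open import Data.Bool using (true)
  open import Data.Empty using (⊥-elim)
  open import Data.Fin using (Fin; suc)
  open import Data.Fin.Patterns using (0F; 1F)
  open import Data.Nat using (ℕ; suc)
  import Data.Integer as ℤ
  open import Function using (_∘_)
  open import Relation.Binary.PropositionalEquality as ≡ using (_≢_)

  open CommutativeRing R hiding (zero)
  open Determinant R
  open ℤ-CoefficientRingSolver R using (solve; _:=_; _:+_; _:*_; :-_; _:-_; con)
  open import Relation.Binary.Reasoning.Setoid setoid

  ↑₂ : ∀ {m} → Fin m → Fin (suc (suc m))
  ↑₂ c = suc (suc c)

  schurComplement : ∀ m → Matrix (suc (suc m)) → Matrix (suc (suc m))
  schurComplement m N j l = N j l - sum (λ c → N (↑₂ c) l * N j (↑₂ c))

  module _ (m : ℕ) (N : Matrix (suc (suc m)))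
           (diagonal≈1 : ∀ r → N (↑₂ r) (↑₂ r) ≈ 1#) (offDiagonal≈0 : ∀ r c → r ≢ c → N (↑₂ r) (↑₂ c) ≈ 0#) where

    private
      Y : Matrix (suc (suc m))
      Y = schurComplement m N

    N₁ N₂ : Matrix (suc (suc m))
    N₁ i 0F      = Y i 0F
    N₁ i (suc j) = N i (suc j)
    N₂ i 1F            = Y i 1F
    N₂ i 0F            = N₁ i 0F
    N₂ i (suc (suc j)) = N₁ i (suc (suc j))

    clearingCoefficient : Fin (suc (suc m)) → Fin (suc (suc m)) → Carrier
    clearingCoefficient l 0F            = 0#
    clearingCoefficient l 1F            = 0#
    clearingCoefficient l (suc (suc c)) = - N (↑₂ c) l

    cleared : ∀ (M : Matrix (suc (suc m))) l → (∀ i c → M i (↑₂ c) ≈ N i (↑₂ c)) → ∀ i →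
              M i l + sum (λ d → clearingCoefficient l d * M i d) ≈ M i l - sum (λ c → N (↑₂ c) l * N i (↑₂ c))
    cleared M l M≈N i = +-congˡ (begin
      0# * M i 0F + (0# * M i 1F + sum (λ c → - N (↑₂ c) l * M i (↑₂ c)))
        ≈⟨ trans (+-cong (zeroˡ _) (trans (+-congʳ (zeroˡ _)) (+-identityˡ _))) (+-identityˡ _) ⟩
      sum (λ c → - N (↑₂ c) l * M i (↑₂ c))
        ≈⟨ sum-cong-≋ (λ c → trans (*-congˡ (M≈N i c)) (solve 2 (λ a b → (:- a) :* b := :- (a :* b)) refl (N (↑₂ c) l) (N i (↑₂ c)))) ⟩
      sum (λ c → - (N (↑₂ c) l * N i (↑₂ c)))
        ≈⟨ sum-neg (λ c → N (↑₂ c) l * N i (↑₂ c)) ⟩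
      - sum (λ c → N (↑₂ c) l * N i (↑₂ c)) ∎)

    det-N₁ : det (suc (suc m)) N₁ ≈ det (suc (suc m)) N
    det-N₁ = det-addColumnCombination (suc (suc m)) 0F (clearingCoefficient 0F) refl agrees
               (λ i → sym (cleared N 0F (λ _ _ → refl) i))
      where
      agrees : AgreeOff 0F N₁ N
      agrees i 0F      0≢0 = ⊥-elim (0≢0 ≡.refl)
      agrees i (suc j) _   = refl

    det-N₂ : det (suc (suc m)) N₂ ≈ det (suc (suc m)) N₁
    det-N₂ = det-addColumnCombination (suc (suc m)) 1F (clearingCoefficient 1F) refl agrees
               (λ i → sym (cleared N₁ 1F (λ _ _ → refl) i))
      where
      agrees : AgreeOff 1F N₂ N₁
      agrees i 0F            _   = refl
      agrees i 1F            1≢1 = ⊥-elim (1≢1 ≡.refl)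
      agrees i (suc (suc j)) _   = refl

    complement-lowerRows : ∀ r l → Y (↑₂ r) l ≈ 0#
    complement-lowerRows r l = begin
      N (↑₂ r) l - sum (λ c → N (↑₂ c) l * N (↑₂ r) (↑₂ c))
        ≈⟨ +-congˡ (-‿cong (sum-single _ r (λ c c≢r → *-zeroʳ-≈ _ (offDiagonal≈0 r c (c≢r ∘ ≡.sym))))) ⟩
      N (↑₂ r) l - N (↑₂ r) l * N (↑₂ r) (↑₂ r)
        ≈⟨ +-congˡ (-‿cong (trans (*-congˡ (diagonal≈1 r)) (*-identityʳ _))) ⟩
      N (↑₂ r) l - N (↑₂ r) l
        ≈⟨ -‿inverseʳ _ ⟩
      0# ∎

    det-schurComplement : det (suc (suc m)) N ≈ Y 0F 0F * Y 1F 1F - Y 1F 0F * Y 0F 1F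
    det-schurComplement = begin
      det (suc (suc m)) N
        ≈⟨ trans det-N₂ det-N₁ ⟨
      det (suc (suc m)) N₂
        ≈⟨ +-cong (*-congˡ minor₀) (+-cong (-‿cong (*-congˡ minor₁)) (signedSum-zero m true (λ i → *-zeroˡ-≈ _ (complement-lowerRows i 0F)))) ⟩
      Y 0F 0F * (Y 1F 1F * 1#) + (- (Y 1F 0F * (Y 0F 1F * 1#)) + 0#)
        ≈⟨ solve 4 (λ a b c d → a :* (b :* con (ℤ.+ 1)) :+ ((:- (c :* (d :* con (ℤ.+ 1)))) :+ con (ℤ.+ 0)) := a :* b :- c :* d) refl (Y 0F 0F) (Y 1F 1F) (Y 1F 0F) (Y 0F 1F) ⟩
      Y 0F 0F * Y 1F 1F - Y 1F 0F * Y 0F 1F ∎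
      where
      identity : det m (λ r c → N (↑₂ r) (↑₂ c)) ≈ 1#
      identity = det-identity m (λ r c → N (↑₂ r) (↑₂ c)) diagonal≈1 offDiagonal≈0
      minor₀ : det (suc m) (minor 0F N₂) ≈ Y 1F 1F * 1#
      minor₀ = trans (det-firstColumn-e₀ m (minor 0F N₂) (λ i → complement-lowerRows i 1F)) (*-congˡ identity)
      minor₁ : det (suc m) (minor 1F N₂) ≈ Y 0F 1F * 1#
      minor₁ = trans (det-firstColumn-e₀ m (minor 1F N₂) (λ i → complement-lowerRows i 1F)) (*-congˡ identity)

module Evaluation {c ℓ c′ ℓ′} (F : Field c ℓ) (S : CommutativeRing c′ ℓ′) {ι : Field.Carrier F → CommutativeRing.Carrier S}
                  (ι-isRingHomomorphism : RingMorphisms.IsRingHomomorphism (Field.rawRing F) (CommutativeRing.rawRing S) ι) where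

  open import Data.Bool using (Bool; true; false; if_then_else_)
  open import Data.Fin using (Fin; zero; suc)
  open import Data.Nat using (zero; suc)
  open import Data.Sum using (_⊎_; inj₁; inj₂; [_,_])
  open import Data.Unit using (tt)
  open import Function using (_∘_)

  open Poly F
  open CommutativeRing S hiding (zero)
  open RingMorphisms.IsRingHomomorphism ι-isRingHomomorphism using (0#-homo; 1#-homo; +-homo; *-homo; -‿homo) renaming (⟦⟧-cong to ι-cong)
  open Determinant S using () renaming (det to detˢ; signedSum to signedSumˢ; signedSum-cong to signedSumˢ-cong)

  ⟦_⟧ : ∀ {V} → Expr V → (V → Carrier) → Carrier
  ⟦ var v ⟧ ρ = ρ v
  ⟦ con a ⟧ ρ = ι a
  ⟦ p ⊕ q ⟧ ρ = ⟦ p ⟧ ρ + ⟦ q ⟧ ρ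
  ⟦ p ⊗ q ⟧ ρ = ⟦ p ⟧ ρ * ⟦ q ⟧ ρ
  ⟦ ⊝ p ⟧   ρ = - ⟦ p ⟧ ρ

  ⟦⟧-cong : ∀ {V} (ρ : V → Carrier) {p q : Expr V} → p ≈ₚ q → ⟦ p ⟧ ρ ≈ ⟦ q ⟧ ρ
  ⟦⟧-cong ρ ≈-refl                = refl
  ⟦⟧-cong ρ (≈-sym p≈q)           = sym (⟦⟧-cong ρ p≈q)
  ⟦⟧-cong ρ (≈-trans p≈q q≈r)     = trans (⟦⟧-cong ρ p≈q) (⟦⟧-cong ρ q≈r)
  ⟦⟧-cong ρ (⊕-cong p≈p′ q≈q′)    = +-cong (⟦⟧-cong ρ p≈p′) (⟦⟧-cong ρ q≈q′)
  ⟦⟧-cong ρ (⊗-cong p≈p′ q≈q′)    = *-cong (⟦⟧-cong ρ p≈p′) (⟦⟧-cong ρ q≈q′)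
  ⟦⟧-cong ρ (⊝-cong p≈q)          = -‿cong (⟦⟧-cong ρ p≈q)
  ⟦⟧-cong ρ (⊕-assoc p q r)       = +-assoc _ _ _
  ⟦⟧-cong ρ (⊕-comm p q)          = +-comm _ _
  ⟦⟧-cong ρ (⊕-idˡ p)             = trans (+-congʳ 0#-homo) (+-identityˡ _)
  ⟦⟧-cong ρ (⊕-invˡ p)            = trans (-‿inverseˡ _) (sym 0#-homo)
  ⟦⟧-cong ρ (⊗-assoc p q r)       = *-assoc _ _ _
  ⟦⟧-cong ρ (⊗-comm p q)          = *-comm _ _
  ⟦⟧-cong ρ (⊗-idˡ p)             = trans (*-congʳ 1#-homo) (*-identityˡ _)
  ⟦⟧-cong ρ (⊗-distribʳ p q r)    = distribʳ _ _ _
  ⟦⟧-cong ρ (con-cong a≈b)        = ι-cong a≈b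
  ⟦⟧-cong ρ (con-+ a b)           = sym (+-homo a b)
  ⟦⟧-cong ρ (con-* a b)           = sym (*-homo a b)
  ⟦⟧-cong ρ (con-- a)             = sym (-‿homo a)

  ⟦⟧-substP : ∀ {V W} (ρ : W → Carrier) (σ : V → Expr W) p → ⟦ substP σ p ⟧ ρ ≈ ⟦ p ⟧ (λ v → ⟦ σ v ⟧ ρ)
  ⟦⟧-substP ρ σ (var v) = refl
  ⟦⟧-substP ρ σ (con a) = refl
  ⟦⟧-substP ρ σ (p ⊕ q) = +-cong (⟦⟧-substP ρ σ p) (⟦⟧-substP ρ σ q)
  ⟦⟧-substP ρ σ (p ⊗ q) = *-cong (⟦⟧-substP ρ σ p) (⟦⟧-substP ρ σ q)
  ⟦⟧-substP ρ σ (⊝ p)   = -‿cong (⟦⟧-substP ρ σ p)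

  ⟦⟧-congˡ : ∀ {V} {ρ ρ′ : V → Carrier} p → (∀ v → ρ v ≈ ρ′ v) → ⟦ p ⟧ ρ ≈ ⟦ p ⟧ ρ′
  ⟦⟧-congˡ (var v) ρ≈ρ′ = ρ≈ρ′ v
  ⟦⟧-congˡ (con a) ρ≈ρ′ = refl
  ⟦⟧-congˡ (p ⊕ q) ρ≈ρ′ = +-cong (⟦⟧-congˡ p ρ≈ρ′) (⟦⟧-congˡ q ρ≈ρ′)
  ⟦⟧-congˡ (p ⊗ q) ρ≈ρ′ = *-cong (⟦⟧-congˡ p ρ≈ρ′) (⟦⟧-congˡ q ρ≈ρ′)
  ⟦⟧-congˡ (⊝ p)   ρ≈ρ′ = -‿cong (⟦⟧-congˡ p ρ≈ρ′)

  ⟦⟧-signedSum : ∀ {V} (ρ : V → Carrier) m s (f : Fin m → Expr V) → ⟦ signedSum m s f ⟧ ρ ≈ signedSumˢ m s (λ i → ⟦ f i ⟧ ρ)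
  ⟦⟧-signedSum ρ zero    s     f = 0#-homo
  ⟦⟧-signedSum ρ (suc m) true  f = +-congˡ (⟦⟧-signedSum ρ m false (f ∘ suc))
  ⟦⟧-signedSum ρ (suc m) false f = +-congˡ (⟦⟧-signedSum ρ m true (f ∘ suc))

  ⟦⟧-det : ∀ {V} (ρ : V → Carrier) k (M : Fin k → Fin k → Expr V) → ⟦ det k M ⟧ ρ ≈ detˢ k (λ i j → ⟦ M i j ⟧ ρ)
  ⟦⟧-det ρ zero    M = 1#-homo
  ⟦⟧-det ρ (suc k) M = trans (⟦⟧-signedSum ρ (suc k) true (λ i → M i zero ⊗ det k (λ r c → M (Data.Fin.punchIn i r) (suc c))))
    (signedSumˢ-cong (suc k) true {λ i → ⟦ M i zero ⟧ ρ * ⟦ det k (λ r c → M (Data.Fin.punchIn i r) (suc c)) ⟧ ρ}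
                     (λ i → *-congˡ (⟦⟧-det ρ k (λ r c → M (Data.Fin.punchIn i r) (suc c)))))
    where import Data.Fin

  ⟦⟧-rename-inj₁ : ∀ {V W} (ρ : V ⊎ W → Carrier) p → ⟦ rename inj₁ p ⟧ ρ ≈ ⟦ p ⟧ (ρ ∘ inj₁)
  ⟦⟧-rename-inj₁ ρ p = ⟦⟧-substP ρ (var ∘ inj₁) p

  setTo : ∀ {V : Set} → (V → Bool) → Carrier → (V → Carrier) → V → Carrier
  setTo T y ρ v = if T v then y else ρ v

  ⟦⟧-ΣS : ∀ {V} (T : V → Bool) p (ρ : V → Carrier) → ⟦ ΣS T p ⟧ ρ ≈ ⟦ p ⟧ (setTo T (ι (Field.0# F)) ρ) + ⟦ p ⟧ (setTo T (ι (Field.1# F)) ρ)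
  ⟦⟧-ΣS T p ρ = +-cong (⟦⟧-setY-collapse (Field.0# F)) (⟦⟧-setY-collapse (Field.1# F))
    where
    ⟦⟧-setY-collapse : ∀ y → ⟦ setY y (collapse T p) ⟧ ρ ≈ ⟦ p ⟧ (setTo T (ι y) ρ)
    ⟦⟧-setY-collapse y = trans (⟦⟧-substP ρ _ (collapse T p)) (trans (⟦⟧-substP _ _ p) (⟦⟧-congˡ p pointwise))
      where
      pointwise : ∀ v → ⟦ var (if T v then inj₂ tt else inj₁ v) ⟧ (λ w → ⟦ [ var , (λ _ → con y) ] w ⟧ ρ) ≈ setTo T (ι y) ρ v
      pointwise v with T v
      ... | true  = refl
      ... | false = refl

module DeterminantalRepresentation {c ℓ} (F : Field c ℓ) where

  open import Data.Fin using (Fin)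
  open import Data.Nat using (ℕ; _≤_; _+_)
  open import Data.Product using (proj₁; proj₂)
  open import Data.Sum using (_⊎_; inj₁; inj₂)
  open import Relation.Nullary using (¬_)

  open Field F hiding (_+_)
  open Determinant commutativeRing using (Matrix; det)
  open FieldLinearAlgebra F using (δ; *-cancelˡ-≈0)
  open Bidual commutativeRing
  open Hessian commutativeRing
  open HessianRankBound F using (hessianRank≤2k)
  open Evaluation F commutativeRingᴮ constant-isRingHomomorphism
  open Poly F using (Expr; var; con; _⊕_; _⊗_; ⊝_; _≈ₚ_; rename; Entry; entry; DetRep)
  open import Relation.Binary.Reasoning.Setoid setoid

  expand : ∀ {V} → Expr V → (x₀ u w : V → Carrier) → Bidual
  expand f x₀ u w = ⟦ f ⟧ (λ v → bidual (x₀ v) (u v) (w v) 0#)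

  expand-c₀ : ∀ {V} (p : Expr V) x₀ u w u′ w′ → c₀ (expand p x₀ u w) ≈ c₀ (expand p x₀ u′ w′)
  expand-c₀ (var v) x₀ u w u′ w′ = refl
  expand-c₀ (con a) x₀ u w u′ w′ = refl
  expand-c₀ (p ⊕ q) x₀ u w u′ w′ = +-cong (expand-c₀ p x₀ u w u′ w′) (expand-c₀ q x₀ u w u′ w′)
  expand-c₀ (p ⊗ q) x₀ u w u′ w′ = *-cong (expand-c₀ p x₀ u w u′ w′) (expand-c₀ q x₀ u w u′ w′)
  expand-c₀ (⊝ p)   x₀ u w u′ w′ = -‿cong (expand-c₀ p x₀ u w u′ w′)

  entryAt : ∀ {V} → (V → Carrier) → Entry V → Carrier
  entryAt x₀ (inj₁ (inj₁ v)) = x₀ v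
  entryAt x₀ (inj₁ (inj₂ _)) = 0#
  entryAt x₀ (inj₂ a)        = a

  entryDerivative : ∀ {V} → (V → Carrier) → Entry V → Carrier
  entryDerivative u (inj₁ (inj₁ v)) = u v
  entryDerivative u (inj₁ (inj₂ _)) = 0#
  entryDerivative u (inj₂ a)        = 0#

  module _ {V} {f : Expr V} {k} (rep : DetRep f k) where

    private
      M : Fin k → Fin k → Entry V
      M = proj₁ rep
      lam : Carrier
      lam = proj₁ (proj₂ rep)
      lam≉0 : ¬ (lam ≈ 0#)
      lam≉0 = proj₁ (proj₂ (proj₂ rep))
      f≈lam·det : rename inj₁ f ≈ₚ con lam ⊗ Poly.det F k (λ i j → entry (M i j))
      f≈lam·det = proj₂ (proj₂ (proj₂ rep))

    atPoint : (V → Carrier) → Matrix k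
    atPoint x₀ i j = entryAt x₀ (M i j)

    derivative : (V → Carrier) → Matrix k
    derivative u i j = entryDerivative u (M i j)

    expand-detRep : ∀ x₀ u w → expand f x₀ u w ≈ᴮ constant lam *ᴮ ᴮ.det k (perturbed (atPoint x₀) (derivative u) (derivative w))
    expand-detRep x₀ u w =
      ᴮ.trans (ᴮ.sym (⟦⟧-rename-inj₁ ρ f)) (ᴮ.trans (⟦⟧-cong ρ f≈lam·det)
        (ᴮ.*-congˡ (ᴮ.trans (⟦⟧-det ρ k (λ i j → entry (M i j))) (ᴮ.det-cong k entry≈))))
      where
      ρ : V ⊎ ℕ → Bidual
      ρ (inj₁ v) = bidual (x₀ v) (u v) (w v) 0#
      ρ (inj₂ _) = 0ᴮ
      entry≈ : ∀ i j → ⟦ entry (M i j) ⟧ ρ ≈ᴮ perturbed (atPoint x₀) (derivative u) (derivative w) i j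
      entry≈ i j with M i j
      ... | inj₁ (inj₁ v) = ᴮ.refl
      ... | inj₁ (inj₂ _) = ᴮ.refl
      ... | inj₂ a        = ᴮ.refl

    detRep⇒hessianRank : ∀ x₀ → c₀ (expand f x₀ (λ _ → 0#) (λ _ → 0#)) ≈ 0# → ∀ {r} (u w : Fin r → V → Carrier) κ →
                         (∀ a b → κ * cεη (expand f x₀ (u a) (w b)) ≈ δ a b) → r ≤ k + k
    detRep⇒hessianRank x₀ f[x₀]≈0 u w κ κHf≈δ =
      hessianRank≤2k k (atPoint x₀) det≈0 (λ a → derivative (u a)) (λ b → derivative (w b)) (κ * lam) κlamH≈δ
      where
      P : ᴮ.Matrix k
      P = perturbed (atPoint x₀) (derivative (λ _ → 0#)) (derivative (λ _ → 0#))
      det≈0 : det k (atPoint x₀) ≈ 0#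
      det≈0 = *-cancelˡ-≈0 lam≉0 (begin
        lam * det k (atPoint x₀)      ≈⟨ *-congˡ (det-homo commutativeRingᴮ commutativeRing c₀-isRingHomomorphism k P) ⟨
        lam * c₀ (ᴮ.det k P)          ≈⟨ ≈c₀ (expand-detRep x₀ (λ _ → 0#) (λ _ → 0#)) ⟨
        c₀ (expand f x₀ (λ _ → 0#) (λ _ → 0#)) ≈⟨ f[x₀]≈0 ⟩
        0#                            ∎)
      κlamH≈δ : ∀ a b → (κ * lam) * hessian k (atPoint x₀) (derivative (u a)) (derivative (w b)) ≈ δ a b
      κlamH≈δ a b = begin
        (κ * lam) * hessian k (atPoint x₀) (derivative (u a)) (derivative (w b))
          ≈⟨ *-assoc κ lam _ ⟩
        κ * (lam * hessian k (atPoint x₀) (derivative (u a)) (derivative (w b)))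
          ≈⟨ *-congˡ (≈cεη (constant-*ᴮ lam _)) ⟨
        κ * cεη (constant lam *ᴮ ᴮ.det k (perturbed (atPoint x₀) (derivative (u a)) (derivative (w b))))
          ≈⟨ *-congˡ (≈cεη (expand-detRep x₀ (u a) (w b))) ⟨
        κ * cεη (expand f x₀ (u a) (w b))
          ≈⟨ κHf≈δ a b ⟩
        δ a b ∎

module ΣS₁₁₂₂-det {c ℓ} (F : Field c ℓ) (char≠2 : CharNot2 F) (m : ℕ) where

  open import Data.Empty using (⊥-elim)
  open import Data.Fin using (Fin; suc; _↑ˡ_; remQuot; combine)
  open import Data.Fin.Patterns using (0F; 1F; 2F; 3F)
  open import Data.Fin.Properties using (all?; combine-remQuot) renaming (_≟_ to _≟ᶠ_)
  import Data.Integer as ℤ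
  open import Data.Nat as ℕ using (suc)
  open import Data.Product using (_×_; _,_; proj₁; proj₂; uncurry)
  open import Data.Unit using (tt)
  open import Function using (_∘_)
  open import Relation.Binary.PropositionalEquality as ≡ using (_≡_; _≢_)
  open import Relation.Nullary using (Dec; yes; no)
  open import Relation.Nullary.Decidable using (toWitness)

  open Field F hiding (zero)
  open Determinant commutativeRing using (sum; sum-zero; sum-single; sum-cong-≋; *-zeroˡ-≈; *-zeroʳ-≈)
  open import Algebra.Properties.Ring ring using (-0#≈0#)
  open FieldLinearAlgebra F using (δ; δ-refl; δ-≢; _⁻¹[_]; *-inverseʳ)
  open Bidual commutativeRing
  open DeterminantalRepresentation F using (expand; expand-c₀)
  open Evaluation F commutativeRingᴮ constant-isRingHomomorphism using (⟦⟧-ΣS; ⟦⟧-det; setTo)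
  open SchurComplement commutativeRingᴮ using (↑₂; schurComplement; det-schurComplement)
  open ℤ-CoefficientRingSolver commutativeRing using (solve; _:=_; _:+_; _:*_; :-_; _:-_; con; fromℤ; fromℤ-+; fromℤ-*; fromℤ-neg)
  open import Relation.Binary.Reasoning.Setoid setoid

  n : ℕ
  n = suc (suc m)

  f : Poly.Expr F (Fin n × Fin n)
  f = Poly.ΣS F S₁₁₂₂ (Poly.detGeneric F n)

  ½ : Carrier
  ½ = (1# + 1#) ⁻¹[ char≠2 ]

  ½+½≈1 : ½ + ½ ≈ 1#
  ½+½≈1 = trans (solve 1 (λ h → h :+ h := (con (ℤ.+ 1) :+ con (ℤ.+ 1)) :* h) refl ½) (*-inverseʳ _ char≠2)

  x₀ : Fin n × Fin n → Carrier
  x₀ (0F , 1F)                   = 1#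
  x₀ (1F , 0F)                   = ½
  x₀ (suc (suc r) , suc (suc c)) = δ r c
  x₀ _                           = 0#

  -- A direction supported on the entries (j , c + 2) and (c + 2 , j) with j < 2.
  record Direction : Set c where
    constructor direction
    field
      rows    : Fin 2 → Fin m → Carrier
      columns : Fin m → Fin 2 → Carrier
  open Direction

  ⟨_⟩ : Direction → Fin n × Fin n → Carrier
  ⟨ d ⟩ (0F , suc (suc c)) = rows d 0F c
  ⟨ d ⟩ (1F , suc (suc c)) = rows d 1F c
  ⟨ d ⟩ (suc (suc r) , 0F) = columns d r 0F
  ⟨ d ⟩ (suc (suc r) , 1F) = columns d r 1F
  ⟨ d ⟩ _                  = 0#

  pairing : Direction → Direction → Fin 2 → Fin 2 → Carrier
  pairing u w j l = sum (λ c → columns u c l * rows w j c + columns w c l * rows u j c)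

  Q : Direction → Direction → Carrier
  Q u w = - pairing u w 0F 0F - pairing u w 1F 1F + pairing u w 0F 1F + (pairing u w 1F 0F + pairing u w 1F 0F)

  module _ (u w : Direction) where

    collapsed : Carrier → ᴮ.Matrix n
    collapsed y i j = setTo S₁₁₂₂ (constant y) (λ v → bidual (x₀ v) (⟨ u ⟩ v) (⟨ w ⟩ v) 0#) (i , j)

    ↑ : Fin 2 → Fin n
    ↑ j = j ↑ˡ m

    block : Carrier → Fin 2 → Fin 2 → Carrier
    block y 0F 0F = y
    block y 0F 1F = 1#
    block y 1F 0F = ½
    block y 1F 1F = y

    collapsed-block : ∀ y j l → collapsed y (↑ j) (↑ l) ≈ᴮ constant (block y j l)
    collapsed-block y 0F 0F = ᴮ.refl
    collapsed-block y 0F 1F = ᴮ.refl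
    collapsed-block y 1F 0F = ᴮ.refl
    collapsed-block y 1F 1F = ᴮ.refl

    collapsed-rows : ∀ y j c → collapsed y (↑ j) (↑₂ c) ≈ᴮ bidual 0# (rows u j c) (rows w j c) 0#
    collapsed-rows y 0F c = ᴮ.refl
    collapsed-rows y 1F c = ᴮ.refl

    collapsed-columns : ∀ y l c → collapsed y (↑₂ c) (↑ l) ≈ᴮ bidual 0# (columns u c l) (columns w c l) 0#
    collapsed-columns y 0F c = ᴮ.refl
    collapsed-columns y 1F c = ᴮ.refl

    collapsed-diagonal : ∀ y r → collapsed y (↑₂ r) (↑₂ r) ≈ᴮ 1ᴮ
    collapsed-diagonal y r = bidual≈ (δ-refl r) refl refl refl

    collapsed-offDiagonal : ∀ y r c → r ≢ c → collapsed y (↑₂ r) (↑₂ c) ≈ᴮ 0ᴮ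
    collapsed-offDiagonal y r c r≢c = bidual≈ (δ-≢ r≢c) refl refl refl

    schurComplement-collapsed : ∀ y j l → schurComplement m (collapsed y) (↑ j) (↑ l) ≈ᴮ bidual (block y j l) 0# 0# (- pairing u w j l)
    schurComplement-collapsed y j l = ᴮ.trans (ᴮ.+-cong (collapsed-block y j l) (ᴮ.-‿cong correction≈))
      (bidual≈ (trans (+-congˡ -0#≈0#) (+-identityʳ _)) (trans (+-congˡ -0#≈0#) (+-identityʳ _))
               (trans (+-congˡ -0#≈0#) (+-identityʳ _)) (+-identityˡ _))
      where
      term : Fin m → Bidual
      term c = collapsed y (↑₂ c) (↑ l) *ᴮ collapsed y (↑ j) (↑₂ c)
      term≈ : ∀ c → term c ≈ᴮ bidual 0# 0# 0# (columns u c l * rows w j c + columns w c l * rows u j c)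
      term≈ c = ᴮ.trans (ᴮ.*-cong (collapsed-columns y l c) (collapsed-rows y j c)) (firstOrder-* _ _ _ _)
      correction≈ : ᴮ.sum term ≈ᴮ bidual 0# 0# 0# (pairing u w j l)
      correction≈ = ᴮ.trans (sumᴮ-components term)
        (bidual≈ (sum-zero (≈c₀ ∘ term≈)) (sum-zero (≈cε ∘ term≈)) (sum-zero (≈cη ∘ term≈)) (sum-cong-≋ (≈cεη ∘ term≈)))

    det-collapsed : ∀ y → ᴮ.det n (collapsed y) ≈ᴮ
      bidual (y * y - ½ * 1#) 0# 0# ((y * - pairing u w 1F 1F + - pairing u w 0F 0F * y) - (½ * - pairing u w 0F 1F + - pairing u w 1F 0F * 1#))
    det-collapsed y = ᴮ.trans (det-schurComplement m (collapsed y) (collapsed-diagonal y) (collapsed-offDiagonal y))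
      (ᴮ.trans (ᴮ.+-cong (ᴮ.*-cong (Y 0F 0F) (Y 1F 1F)) (ᴮ.-‿cong (ᴮ.*-cong (Y 1F 0F) (Y 0F 1F))))
      (ᴮ.trans (ᴮ.+-cong (noFirstOrder-* _ _ _ _) (ᴮ.-‿cong (noFirstOrder-* _ _ _ _)))
      (bidual≈ refl (trans (+-congˡ -0#≈0#) (+-identityʳ _)) (trans (+-congˡ -0#≈0#) (+-identityʳ _)) refl)))
      where
      Y = schurComplement-collapsed y

    expand-f : expand f x₀ ⟨ u ⟩ ⟨ w ⟩ ≈ᴮ ᴮ.det n (collapsed 0#) +ᴮ ᴮ.det n (collapsed 1#)
    expand-f = ᴮ.trans (⟦⟧-ΣS S₁₁₂₂ (Poly.detGeneric F n) _)
      (ᴮ.+-cong (⟦⟧-det _ n (λ i j → Poly.var (i , j))) (⟦⟧-det _ n (λ i j → Poly.var (i , j))))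

    c₀-expand-f : c₀ (expand f x₀ ⟨ u ⟩ ⟨ w ⟩) ≈ 0#
    c₀-expand-f = begin
      c₀ (expand f x₀ ⟨ u ⟩ ⟨ w ⟩)
        ≈⟨ ≈c₀ (ᴮ.trans expand-f (ᴮ.+-cong (det-collapsed 0#) (det-collapsed 1#))) ⟩
      (0# * 0# - ½ * 1#) + (1# * 1# - ½ * 1#)
        ≈⟨ solve 1 (λ h → (con (ℤ.+ 0) :* con (ℤ.+ 0) :- h :* con (ℤ.+ 1)) :+ (con (ℤ.+ 1) :* con (ℤ.+ 1) :- h :* con (ℤ.+ 1))
                          := con (ℤ.+ 1) :- (h :+ h)) refl ½ ⟩
      1# - (½ + ½)
        ≈⟨ +-congˡ (-‿cong ½+½≈1) ⟩
      1# - 1#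
        ≈⟨ -‿inverseʳ 1# ⟩
      0# ∎

    cεη-expand-f : cεη (expand f x₀ ⟨ u ⟩ ⟨ w ⟩) ≈ Q u w
    cεη-expand-f = begin
      cεη (expand f x₀ ⟨ u ⟩ ⟨ w ⟩)
        ≈⟨ ≈cεη (ᴮ.trans expand-f (ᴮ.+-cong (det-collapsed 0#) (det-collapsed 1#))) ⟩
      ((0# * - T₁₁ + - T₀₀ * 0#) - (½ * - T₀₁ + - T₁₀ * 1#)) + ((1# * - T₁₁ + - T₀₀ * 1#) - (½ * - T₀₁ + - T₁₀ * 1#))
        ≈⟨ solve 5 (λ t₀₀ t₀₁ t₁₀ t₁₁ h →
             ((con (ℤ.+ 0) :* (:- t₁₁) :+ (:- t₀₀) :* con (ℤ.+ 0)) :- (h :* (:- t₀₁) :+ (:- t₁₀) :* con (ℤ.+ 1)))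
             :+ ((con (ℤ.+ 1) :* (:- t₁₁) :+ (:- t₀₀) :* con (ℤ.+ 1)) :- (h :* (:- t₀₁) :+ (:- t₁₀) :* con (ℤ.+ 1)))
             := (:- t₀₀) :- t₁₁ :+ (h :+ h) :* t₀₁ :+ (t₁₀ :+ t₁₀)) refl T₀₀ T₀₁ T₁₀ T₁₁ ½ ⟩
      - T₀₀ - T₁₁ + (½ + ½) * T₀₁ + (T₁₀ + T₁₀)
        ≈⟨ +-congʳ (+-congˡ (trans (*-congʳ ½+½≈1) (*-identityˡ _))) ⟩
      Q u w ∎
      where
      T₀₀ = pairing u w 0F 0F
      T₀₁ = pairing u w 0F 1F
      T₁₀ = pairing u w 1F 0F
      T₁₁ = pairing u w 1F 1F

  f[x₀]≈0 : c₀ (expand f x₀ (λ _ → 0#) (λ _ → 0#)) ≈ 0#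
  f[x₀]≈0 = trans (expand-c₀ f x₀ _ _ ⟨ 0ᵈ ⟩ ⟨ 0ᵈ ⟩) (c₀-expand-f 0ᵈ 0ᵈ)
    where
    0ᵈ : Direction
    0ᵈ = direction (λ _ _ → 0#) (λ _ _ → 0#)

  δℤ : ∀ {k} → Fin k → Fin k → ℤ.ℤ
  δℤ a b with a ≟ᶠ b
  ... | yes _ = ℤ.1ℤ
  ... | no  _ = ℤ.0ℤ

  fromℤ-δℤ : ∀ {k} (a b : Fin k) → fromℤ (δℤ a b) ≈ δ a b
  fromℤ-δℤ a b with a ≟ᶠ b
  ... | yes _ = refl
  ... | no  _ = refl

  -- At a single column c, Q is the pairing (b , γ) , (b′ , γ′) ↦ Σ_{j,l} A j l (γ l b′ j + γ′ l b j)
  -- with A = [[-1, 1], [2, -1]]; pairing unit vectors with the rows of −(A⁻¹)ᵀ gives −δ.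
  −A⁻¹ᵀ : Fin 2 → Fin 2 → ℤ.ℤ
  −A⁻¹ᵀ 0F 0F = ℤ.-1ℤ
  −A⁻¹ᵀ 0F 1F = ℤ.- (ℤ.+ 2)
  −A⁻¹ᵀ 1F 0F = ℤ.-1ℤ
  −A⁻¹ᵀ 1F 1F = ℤ.-1ℤ

  rowsU columnsU rowsW columnsW : Fin 4 → Fin 2 → ℤ.ℤ
  rowsU 0F j    = δℤ j 0F
  rowsU 1F j    = δℤ j 1F
  rowsU _  j    = ℤ.0ℤ
  columnsU 2F l = δℤ l 0F
  columnsU 3F l = δℤ l 1F
  columnsU _  l = ℤ.0ℤ
  rowsW 2F j    = −A⁻¹ᵀ j 0F
  rowsW 3F j    = −A⁻¹ᵀ j 1F
  rowsW _  j    = ℤ.0ℤ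
  columnsW 0F l = −A⁻¹ᵀ 0F l
  columnsW 1F l = −A⁻¹ᵀ 1F l
  columnsW _  l = ℤ.0ℤ

  pairingℤ : Fin 4 → Fin 4 → Fin 2 → Fin 2 → ℤ.ℤ
  pairingℤ q q′ j l = columnsU q l ℤ.* rowsW q′ j ℤ.+ columnsW q′ l ℤ.* rowsU q j

  Qℤ : Fin 4 → Fin 4 → ℤ.ℤ
  Qℤ q q′ = ℤ.- pairingℤ q q′ 0F 0F ℤ.- pairingℤ q q′ 1F 1F ℤ.+ pairingℤ q q′ 0F 1F
            ℤ.+ (pairingℤ q q′ 1F 0F ℤ.+ pairingℤ q q′ 1F 0F)

  Qℤ≡-δℤ : ∀ q q′ → Qℤ q q′ ≡ ℤ.- δℤ q q′
  Qℤ≡-δℤ = toWitness {a? = all? (λ q → all? (λ q′ → Qℤ q q′ ℤ.≟ ℤ.- δℤ q q′))} tt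

  atColumn : Fin m → (Fin 4 → Fin 2 → ℤ.ℤ) → Fin 4 → Fin m → Fin 2 → Carrier
  atColumn c table q c′ j = δ c′ c * fromℤ (table q j)

  witnessU witnessW : Fin 4 → Fin m → Direction
  witnessU q c = direction (λ j c′ → atColumn c rowsU q c′ j) (λ c′ l → atColumn c columnsU q c′ l)
  witnessW q c = direction (λ j c′ → atColumn c rowsW q c′ j) (λ c′ l → atColumn c columnsW q c′ l)

  pairing-witness : ∀ q c q′ c′ j l → pairing (witnessU q c) (witnessW q′ c′) j l ≈ δ c c′ * fromℤ (pairingℤ q q′ j l)
  pairing-witness q c q′ c′ j l = begin
    sum (λ c″ → (δ c″ c * γ) * (δ c″ c′ * b′) + (δ c″ c′ * γ′) * (δ c″ c * b))
      ≈⟨ sum-cong-≋ (λ c″ → solve 6 (λ d d′ γ b′ γ′ b → (d :* γ) :* (d′ :* b′) :+ (d′ :* γ′) :* (d :* b) := d :* (d′ :* (γ :* b′ :+ γ′ :* b)))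
                                    refl (δ c″ c) (δ c″ c′) γ b′ γ′ b) ⟩
    sum (λ c″ → δ c″ c * (δ c″ c′ * (γ * b′ + γ′ * b)))
      ≈⟨ sum-single _ c (λ c″ c″≢c → *-zeroˡ-≈ _ (δ-≢ c″≢c)) ⟩
    δ c c * (δ c c′ * (γ * b′ + γ′ * b))
      ≈⟨ trans (*-congʳ (δ-refl c)) (*-identityˡ _) ⟩
    δ c c′ * (γ * b′ + γ′ * b)
      ≈⟨ *-congˡ (trans (fromℤ-+ (columnsU q l ℤ.* rowsW q′ j) (columnsW q′ l ℤ.* rowsU q j))
                         (+-cong (fromℤ-* (columnsU q l) (rowsW q′ j)) (fromℤ-* (columnsW q′ l) (rowsU q j)))) ⟨
    δ c c′ * fromℤ (pairingℤ q q′ j l) ∎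
    where
    γ  = fromℤ (columnsU q l)
    b′ = fromℤ (rowsW q′ j)
    γ′ = fromℤ (columnsW q′ l)
    b  = fromℤ (rowsU q j)

  Q-witness : ∀ q c q′ c′ → Q (witnessU q c) (witnessW q′ c′) ≈ - (δ q q′ * δ c c′)
  Q-witness q c q′ c′ = begin
    - T 0F 0F - T 1F 1F + T 0F 1F + (T 1F 0F + T 1F 0F)
      ≈⟨ +-cong (+-cong (+-cong (-‿cong (P 0F 0F)) (-‿cong (P 1F 1F))) (P 0F 1F)) (+-cong (P 1F 0F) (P 1F 0F)) ⟩
    - (d * x 0F 0F) - d * x 1F 1F + d * x 0F 1F + (d * x 1F 0F + d * x 1F 0F)
      ≈⟨ solve 5 (λ d a b c e → (:- (d :* a)) :- d :* b :+ d :* c :+ (d :* e :+ d :* e) := d :* ((:- a) :- b :+ c :+ (e :+ e)))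
                 refl d (x 0F 0F) (x 1F 1F) (x 0F 1F) (x 1F 0F) ⟩
    d * (- x 0F 0F - x 1F 1F + x 0F 1F + (x 1F 0F + x 1F 0F))
      ≈⟨ *-congˡ fromℤ-Qℤ ⟨
    d * fromℤ (Qℤ q q′)
      ≈⟨ *-congˡ (trans (reflexive (≡.cong fromℤ (Qℤ≡-δℤ q q′))) (trans (fromℤ-neg (δℤ q q′)) (-‿cong (fromℤ-δℤ q q′)))) ⟩
    d * - δ q q′
      ≈⟨ solve 2 (λ d e → d :* (:- e) := :- (e :* d)) refl d (δ q q′) ⟩
    - (δ q q′ * δ c c′) ∎
    where
    T = pairing (witnessU q c) (witnessW q′ c′)
    P = pairing-witness q c q′ c′
    d = δ c c′
    x : Fin 2 → Fin 2 → Carrier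
    x j l = fromℤ (pairingℤ q q′ j l)
    fromℤ-Qℤ : fromℤ (Qℤ q q′) ≈ - x 0F 0F - x 1F 1F + x 0F 1F + (x 1F 0F + x 1F 0F)
    fromℤ-Qℤ = trans (fromℤ-+ (ℤ.- p 0F 0F ℤ.- p 1F 1F ℤ.+ p 0F 1F) (p 1F 0F ℤ.+ p 1F 0F)) (+-cong
      (trans (fromℤ-+ (ℤ.- p 0F 0F ℤ.- p 1F 1F) (p 0F 1F))
             (+-congʳ (trans (fromℤ-+ (ℤ.- p 0F 0F) (ℤ.- p 1F 1F)) (+-cong (fromℤ-neg (p 0F 0F)) (fromℤ-neg (p 1F 1F))))))
      (fromℤ-+ (p 1F 0F) (p 1F 0F)))
      where p = pairingℤ q q′

  witnessesU witnessesW : Fin (4 ℕ.* m) → Direction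
  witnessesU a = uncurry witnessU (remQuot m a)
  witnessesW b = uncurry witnessW (remQuot m b)

  δ-remQuot : ∀ (a b : Fin (4 ℕ.* m)) → δ a b ≈ δ (proj₁ (remQuot m a)) (proj₁ (remQuot m b)) * δ (proj₂ (remQuot m a)) (proj₂ (remQuot m b))
  δ-remQuot a b = byCases (a ≟ᶠ b) (q ≟ᶠ q′) (r ≟ᶠ r′)
    where
    q = proj₁ (remQuot m a)
    q′ = proj₁ (remQuot m b)
    r = proj₂ (remQuot m a)
    r′ = proj₂ (remQuot m b)
    byCases : Dec (a ≡ b) → Dec (q ≡ q′) → Dec (r ≡ r′) → δ a b ≈ δ q q′ * δ r r′
    byCases (yes ≡.refl) _         _         = trans (δ-refl a) (sym (trans (*-cong (δ-refl q) (δ-refl r)) (*-identityˡ 1#)))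
    byCases (no a≢b)     (yes q≡q′) (yes r≡r′) = ⊥-elim (a≢b (≡.trans (≡.sym (combine-remQuot {4} m a))
                                                   (≡.trans (≡.cong₂ combine q≡q′ r≡r′) (combine-remQuot {4} m b))))
    byCases (no a≢b)     (no q≢q′)  _         = trans (δ-≢ a≢b) (sym (*-zeroˡ-≈ _ (δ-≢ q≢q′)))
    byCases (no a≢b)     (yes _)    (no r≢r′) = trans (δ-≢ a≢b) (sym (*-zeroʳ-≈ _ (δ-≢ r≢r′)))

  hessian-witnesses : ∀ a b → - 1# * cεη (expand f x₀ ⟨ witnessesU a ⟩ ⟨ witnessesW b ⟩) ≈ δ a b
  hessian-witnesses a b = begin
    - 1# * cεη (expand f x₀ ⟨ witnessesU a ⟩ ⟨ witnessesW b ⟩)   ≈⟨ *-congˡ (cεη-expand-f (witnessesU a) (witnessesW b)) ⟩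
    - 1# * Q (witnessesU a) (witnessesW b)                        ≈⟨ *-congˡ (Q-witness q r q′ r′) ⟩
    - 1# * - (δ q q′ * δ r r′)                                    ≈⟨ solve 1 (λ x → (:- con (ℤ.+ 1)) :* (:- x) := x) refl (δ q q′ * δ r r′) ⟩
    δ q q′ * δ r r′                                               ≈⟨ δ-remQuot a b ⟨
    δ a b                                                         ∎
    where
    q = proj₁ (remQuot m a)
    q′ = proj₁ (remQuot m b)
    r = proj₂ (remQuot m a)
    r′ = proj₂ (remQuot m b)

open import Data.Nat using (ℕ; _≤_; _*_; _∸_)
open import Level using (Level)
open import Data.Nat using (suc; s≤s; z≤n; _+_)

mainTheorem4 : ∀ {c ℓ : Level} (F : Field c ℓ) → CharNot2 F →
    ∀ (n : ℕ) → 2 ≤ n →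
      Poly.dc≥ F (Poly.ΣS F S₁₁₂₂ (Poly.detGeneric F n)) (2 * (n ∸ 2))
mainTheorem4 F char≠2 (suc (suc m)) (s≤s (s≤s z≤n)) k rep = *-cancelˡ-≤ 2 (begin
  2 * (2 * m)  ≡⟨ *-assoc 2 2 m ⟨
  4 * m        ≤⟨ detRep⇒hessianRank {f = f} rep x₀ f[x₀]≈0 (⟨_⟩ ∘ witnessesU) (⟨_⟩ ∘ witnessesW) (- 1#) hessian-witnesses ⟩
  k + k        ≡⟨ cong (k +_) (+-identityʳ k) ⟨
  2 * k        ∎)
  where
  open import Data.Nat.Properties using (*-cancelˡ-≤; *-assoc; +-identityʳ; module ≤-Reasoning)
  open import Relation.Binary.PropositionalEquality using (cong)
  open ≤-Reasoning
  open import Function using (_∘_)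
  open Field F using (1#; -_)
  open ΣS₁₁₂₂-det F char≠2 m
  open DeterminantalRepresentation F
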